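{- For every integer $n\geq 3$, the dominating graph $\mathcal{D}(C_n)$ of the cycle $C_n$ on $n$ vertices has a Hamilton path if and only if $n\not\equiv 0 \pmod 4$.
   Context: All graphs are finite and simple. For a graph $H$, a dominating set of $H$ is a set $D\subseteq V(H)$ such that every vertex of $V(H)\setminus D$ is adjacent to a vertex of $D$. The dominating graph $\mathcal{D}(H)$ is the graph whose vertices are all dominating sets of $H$, in which two distinct dominating sets $X,Y$ are adjacent if and only if $Y$ is obtained from $X$ by adding a single vertex of $H$ or deleting a single vertex of $X$ (i.e. $|X\triangle Y|=1$). -}

module Defs where

open import Data.Nat using (ℕ; zero; suc; _∸_)
open import Data.Fin using (Fin; toℕ)
open import Data.Bool using (Bool; true; false)
open import Data.Vec using (Vec; lookup)
open import Data.Fin.Subset using (Subset; _∈_)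
open import Data.List using (List; []; _∷_)
open import Data.List.Relation.Unary.All using (All)
open import Data.List.Relation.Unary.Unique.Propositional using (Unique)
import Data.List.Membership.Propositional as LMem
open import Data.Product using (Σ; ∃; _×_)
open import Data.Sum using (_⊎_)
open import Relation.Binary.PropositionalEquality using (_≡_; _≢_)

SuccC : (n : ℕ) → Fin n → Fin n → Set
SuccC n i j = (toℕ j ≡ suc (toℕ i)) ⊎ ((toℕ i ≡ n ∸ 1) × (toℕ j ≡ 0))

CycleAdj : (n : ℕ) → Fin n → Fin n → Set
CycleAdj n i j = SuccC n i j ⊎ SuccC n j i

Dominating : (n : ℕ) → Subset n → Set
Dominating n D = (v : Fin n) → (v ∈ D) ⊎ (∃ λ u → (u ∈ D) × CycleAdj n u v)

-- Adjacency in the dominating graph: |X △ Y| = 1.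
OneFlip : (n : ℕ) → Subset n → Subset n → Set
OneFlip n X Y = ∃ λ (v : Fin n) →
  (lookup X v ≢ lookup Y v) × ((w : Fin n) → w ≢ v → lookup X w ≡ lookup Y w)

Chain : {A : Set} → (A → A → Set) → List A → Set
Chain R [] = Data.Unit.⊤ where import Data.Unit
Chain R (x ∷ []) = Data.Unit.⊤ where import Data.Unit
Chain R (x ∷ y ∷ xs) = R x y × Chain R (y ∷ xs)

HamiltonPathDomGraph : (n : ℕ) → List (Subset n) → Set
HamiltonPathDomGraph n P =
  All (Dominating n) P ×
  Unique P ×
  ((D : Subset n) → Dominating n D → D LMem.∈ P) ×
  Chain (OneFlip n) P

HasHamiltonPathDomGraph : ℕ → Set
HasHamiltonPathDomGraph n = ∃ λ (P : List (Subset n)) → HamiltonPathDomGraph n P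

-- A set D is dominating in C_n exactly when its characteristic word, read cyclically, has no three
-- consecutive zeros, and adding or removing a vertex flips one bit. For n ≥ 6 every such cyclic word
-- arises in exactly one way by framing a linear word without 000 between fixed bits around
-- position 0. The linear words of each length carry Gray codes following the recursion
-- 1·L(k-1), 001·L(k-3), 01·L(k-2); for n ≢ 0 (mod 4) the framed Gray codes, two of them zigzagging
-- through a free bit when n ≡ 2 (mod 4), chain into a Hamilton path. The dominating graph is bipartite
-- by the parity of |D|, and for n ≡ 0 (mod 4) there are three more even than odd dominating sets,
-- while a path alternates between the classes and so unbalances them by at most one. Lengths 3, 4, 5
-- are settled by search.

module Submission where

open import Defs
open import Data.Nat using (ℕ; zero; suc; _+_; _*_; _≤_; _<_; z≤n; s≤s)
open import Data.Nat.Properties using (≤-reflexive; ≤-trans; n≤1+n; <-cmp; <⇒≱; suc-injective; +-comm; +-assoc; +-identityʳ)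
open import Data.Nat.Divisibility using (_∣_; _∣?_; divides; ∣-trans; ∣m+n∣m⇒∣n; n∣m*n)
open import Data.Bool as Bool using (Bool; true; false; _∧_; _∨_; not; _xor_; if_then_else_)
import Data.Bool.Properties as Bool
open import Data.Bool.Properties using (∨-zeroʳ; ∧-assoc; ∧-comm; ∧-identityʳ)
open import Data.List using (List; []; _∷_; _++_; [_]; length; map; concat; foldl; foldr; allFin)
open import Data.List.Properties using (++-assoc; ++-identityʳ; length-++; foldl-++)
open import Data.Vec as V using (Vec; lookup; toList; _∷ʳ_)
open import Data.Vec.Properties as VecP using ([]=⇒lookup; lookup⇒[]=; length-toList; tabulate∘lookup; tabulate-cong)
open import Data.Fin as Fin using (Fin; toℕ; fromℕ<; #_)
open import Data.Fin.Properties as FinP using (toℕ<n; toℕ-fromℕ<; toℕ-fromℕ)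
import Data.Fin.Subset as Subset
open import Data.Fin.Subset.Properties using (anySubset?)
open import Data.Product using (∃; ∃₂; _×_; _,_; -,_; proj₁; proj₂)
open import Data.Sum using (_⊎_; inj₁; inj₂; [_,_]′)
open import Data.Empty using (⊥-elim)
open import Data.Unit using (tt)
open import Relation.Nullary using (¬_; Dec; yes; no; ¬?; _×-dec_)
import Relation.Nullary.Decidable as Dec
open import Relation.Nullary.Decidable using (True; False; toWitness; toWitnessFalse; from-no)
open import Relation.Binary.Definitions using (tri<; tri≈; tri>)
open import Relation.Binary.PropositionalEquality hiding ([_])
open import Data.List.Membership.Propositional using (_∈_)
open import Data.List.Membership.Propositional.Properties using (∈-map⁺; ∈-map⁻; ∈-++⁺ˡ; ∈-++⁺ʳ; ∈-++⁻; ∈-allFin)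
open import Data.List.Membership.DecPropositional (FinP._≟_ {10}) using (_∈?_)
open import Data.List.Relation.Unary.Unique.DecPropositional (FinP._≟_ {10}) using (unique?)
open import Data.List.Relation.Unary.Any using (here; there)
open import Data.List.Relation.Unary.All as All using (All; []; _∷_)
import Data.List.Relation.Unary.All.Properties as AllP
open import Data.List.Relation.Unary.AllPairs using ([]; _∷_)
open import Data.List.Relation.Unary.Unique.Propositional using (Unique)
import Data.List.Relation.Unary.Unique.Propositional.Properties as UP
open import Data.List.Relation.Binary.Disjoint.Propositional using (Disjoint)
open import Data.List.Relation.Unary.Linked using (Linked; []; [-]; _∷_; linked?)
open import Data.List.Relation.Binary.Permutation.Propositional as ↭ using (_↭_)
open import Data.List.Relation.Binary.BagAndSetEquality using (∼bag⇒↭)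
open import Data.List.Membership.Propositional.Properties.WithK using (unique∧set⇒bag)
open import Data.Integer using (ℤ; +_; -_; ∣_∣) renaming (_+_ to _⊕_)
import Data.Integer.Properties as ℤ
open import Algebra.Bundles using (CommutativeRing)
open import Algebra.Properties.CommutativeSemigroup ℤ.+-commutativeSemigroup
  using () renaming (x∙yz≈z∙yx to ℤ-rotate)
open import Algebra.Properties.CommutativeSemigroup
  (CommutativeRing.+-commutativeSemigroup Bool.xor-∧-commutativeRing)
  using () renaming (x∙yz≈z∙yx to xor-rotate)
open import Function.Base using (_∘_; case_of_)
open import Function.Bundles using (_⇔_; mk⇔; Equivalence)

open ≡-Reasoning

-- Words without three consecutive zeros

hasOne : Bool → Bool → Bool → Bool
hasOne a b c = a ∨ b ∨ c

no000 : List Bool → Bool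
no000 (a ∷ b ∷ c ∷ r) = hasOne a b c ∧ no000 (b ∷ c ∷ r)
no000 _ = true

∧-trueˡ : ∀ x {y} → x ∧ y ≡ true → x ≡ true
∧-trueˡ true _ = refl

∧-trueʳ : ∀ x {y} → x ∧ y ≡ true → y ≡ true
∧-trueʳ true p = p

no000-tail : ∀ a l → no000 (a ∷ l) ≡ true → no000 l ≡ true
no000-tail a [] _ = refl
no000-tail a (b ∷ []) _ = refl
no000-tail a (b ∷ c ∷ r) p = ∧-trueʳ (hasOne a b c) p

no000-++ˡ : ∀ l r → no000 (l ++ r) ≡ true → no000 l ≡ true
no000-++ˡ [] r _ = refl
no000-++ˡ (a ∷ []) r _ = refl
no000-++ˡ (a ∷ b ∷ []) r _ = refl
no000-++ˡ (a ∷ b ∷ c ∷ l) r p =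
  cong₂ _∧_ (∧-trueˡ (hasOne a b c) p) (no000-++ˡ (b ∷ c ∷ l) r (∧-trueʳ (hasOne a b c) p))

no000-++ʳ : ∀ l r → no000 (l ++ r) ≡ true → no000 r ≡ true
no000-++ʳ [] r p = p
no000-++ʳ (a ∷ l) r p = no000-++ʳ l r (no000-tail a (l ++ r) p)

no000-1∷ : ∀ l → no000 (true ∷ l) ≡ no000 l
no000-1∷ [] = refl
no000-1∷ (_ ∷ []) = refl
no000-1∷ (_ ∷ _ ∷ _) = refl

no000-∷1∷ : ∀ a l → no000 (a ∷ true ∷ l) ≡ no000 l
no000-∷1∷ a [] = refl
no000-∷1∷ a (c ∷ r) rewrite ∨-zeroʳ a = no000-1∷ (c ∷ r)

no000-++1∷ : ∀ l r → no000 (l ++ true ∷ r) ≡ no000 l ∧ no000 r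
no000-++1∷ [] r = no000-1∷ r
no000-++1∷ (a ∷ []) r = no000-∷1∷ a r
no000-++1∷ (a ∷ b ∷ []) r rewrite ∨-zeroʳ b | ∨-zeroʳ a = no000-∷1∷ b r
no000-++1∷ (a ∷ b ∷ c ∷ l) r =
  trans (cong (hasOne a b c ∧_) (no000-++1∷ (b ∷ c ∷ l) r)) (sym (∧-assoc (hasOne a b c) _ _))

lastOr : Bool → List Bool → Bool
lastOr a [] = a
lastOr a (b ∷ l) = lastOr b l

lastOr-++ : ∀ a l b r → lastOr a (l ++ b ∷ r) ≡ lastOr b r
lastOr-++ a [] b r = refl
lastOr-++ a (c ∷ l) b r = lastOr-++ c l b r

no000-++∷ : ∀ q a r → no000 (q ++ a ∷ r) ≡ no000 (q ++ [ a ]) ∧ no000 (lastOr true q ∷ a ∷ r)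
no000-++∷ [] a r = sym (no000-1∷ (a ∷ r))
no000-++∷ (c ∷ []) a r = refl
no000-++∷ (c ∷ d ∷ []) a r = cong (_∧ no000 (d ∷ a ∷ r)) (sym (∧-identityʳ (hasOne c d a)))
no000-++∷ (c ∷ d ∷ e ∷ q) a r =
  trans (cong (hasOne c d e ∧_) (no000-++∷ (d ∷ e ∷ q) a r)) (sym (∧-assoc (hasOne c d e) _ _))

-- The cyclic word a ∷ l is unrolled so that its windows of three become those of a linear word.
cyclicᴸ : List Bool → Bool
cyclicᴸ [] = true
cyclicᴸ (a ∷ l) = no000 (lastOr a l ∷ a ∷ l ++ [ a ])

cyclic-cut : ∀ p q → cyclicᴸ (p ++ true ∷ q) ≡ no000 (q ++ p)
cyclic-cut [] q = begin
  no000 (lastOr true q ∷ true ∷ q ++ [ true ]) ≡⟨ no000-∷1∷ _ (q ++ [ true ]) ⟩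
  no000 (q ++ [ true ])                         ≡⟨ no000-++1∷ q [] ⟩
  no000 q ∧ true                                ≡⟨ ∧-identityʳ _ ⟩
  no000 q                                       ≡⟨ cong no000 (++-identityʳ q) ⟨
  no000 (q ++ [])                               ∎
cyclic-cut (a ∷ p) q = begin
  no000 (lastOr a (p ++ true ∷ q) ∷ a ∷ (p ++ true ∷ q) ++ [ a ])
    ≡⟨ cong₂ (λ ℓ t → no000 (ℓ ∷ a ∷ t)) (lastOr-++ a p true q) (++-assoc p (true ∷ q) [ a ]) ⟩
  no000 ((lastOr true q ∷ a ∷ p) ++ true ∷ q ++ [ a ])
    ≡⟨ no000-++1∷ (lastOr true q ∷ a ∷ p) (q ++ [ a ]) ⟩
  no000 (lastOr true q ∷ a ∷ p) ∧ no000 (q ++ [ a ])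
    ≡⟨ ∧-comm (no000 (lastOr true q ∷ a ∷ p)) _ ⟩
  no000 (q ++ [ a ]) ∧ no000 (lastOr true q ∷ a ∷ p)
    ≡⟨ no000-++∷ q a p ⟨
  no000 (q ++ a ∷ p) ∎

cyclic-cut₂ : ∀ p l s → cyclicᴸ (p ++ true ∷ l ++ true ∷ s) ≡ no000 l ∧ no000 (s ++ p)
cyclic-cut₂ p l s = begin
  cyclicᴸ (p ++ true ∷ l ++ true ∷ s) ≡⟨ cyclic-cut p (l ++ true ∷ s) ⟩
  no000 ((l ++ true ∷ s) ++ p)        ≡⟨ cong no000 (++-assoc l (true ∷ s) p) ⟩
  no000 (l ++ true ∷ s ++ p)          ≡⟨ no000-++1∷ l (s ++ p) ⟩
  no000 l ∧ no000 (s ++ p)            ∎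

linear : ∀ {k} → Vec Bool k → Bool
linear z = no000 (toList z)

Linear : ∀ {k} → Vec Bool k → Set
Linear z = linear z ≡ true

cyclic : ∀ {k} → Vec Bool k → Bool
cyclic x = cyclicᴸ (toList x)

toList-∷ʳ₂ : ∀ {A : Set} {k} (xs : Vec A k) a b → toList (xs ∷ʳ a ∷ʳ b) ≡ toList xs ++ a ∷ b ∷ []
toList-∷ʳ₂ V.[] a b = refl
toList-∷ʳ₂ (x V.∷ xs) a b = cong (x ∷_) (toList-∷ʳ₂ xs a b)

toList-∷ʳ₃ : ∀ {A : Set} {k} (xs : Vec A k) a b c → toList (xs ∷ʳ a ∷ʳ b ∷ʳ c) ≡ toList xs ++ a ∷ b ∷ c ∷ []
toList-∷ʳ₃ V.[] a b c = refl
toList-∷ʳ₃ (x V.∷ xs) a b c = cong (x ∷_) (toList-∷ʳ₃ xs a b c)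

toList-∷ʳ₄ : ∀ {A : Set} {k} (xs : Vec A k) a b c d →
             toList (xs ∷ʳ a ∷ʳ b ∷ʳ c ∷ʳ d) ≡ toList xs ++ a ∷ b ∷ c ∷ d ∷ []
toList-∷ʳ₄ V.[] a b c d = refl
toList-∷ʳ₄ (x V.∷ xs) a b c d = cong (x ∷_) (toList-∷ʳ₄ xs a b c d)

cyclic-framed : ∀ {k j} (x : Vec Bool j) (z : Vec Bool k) p s →
                toList x ≡ p ++ true ∷ toList z ++ true ∷ s → no000 (s ++ p) ≡ true → cyclic x ≡ linear z
cyclic-framed x z p s x≡psz ok = begin
  cyclicᴸ (toList x)                       ≡⟨ cong cyclicᴸ x≡psz ⟩
  cyclicᴸ (p ++ true ∷ toList z ++ true ∷ s) ≡⟨ cyclic-cut₂ p (toList z) s ⟩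
  linear z ∧ no000 (s ++ p)                ≡⟨ cong (linear z ∧_) ok ⟩
  linear z ∧ true                          ≡⟨ ∧-identityʳ (linear z) ⟩
  linear z                                 ∎

cyclic⇒linear : ∀ {k} (x : Vec Bool k) → cyclic x ≡ true → linear x ≡ true
cyclic⇒linear V.[] _ = refl
cyclic⇒linear (a V.∷ x) p =
  no000-++ˡ (a ∷ toList x) [ a ] (no000-tail (lastOr a (toList x)) (a ∷ toList x ++ [ a ]) p)

-- Dominating sets of the cycle as cyclic words

bitAt : List Bool → ℕ → Bool
bitAt [] _ = false
bitAt (a ∷ l) zero = a
bitAt (a ∷ l) (suc i) = bitAt l i

window : List Bool → ℕ → Bool
window l i = hasOne (bitAt l i) (bitAt l (suc i)) (bitAt l (suc (suc i)))

window-left : ∀ l i → bitAt l i ≡ true → window l i ≡ true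
window-left l i b rewrite b = refl

window-mid : ∀ l i → bitAt l (suc i) ≡ true → window l i ≡ true
window-mid l i b rewrite b = ∨-zeroʳ (bitAt l i)

window-right : ∀ l i → bitAt l (suc (suc i)) ≡ true → window l i ≡ true
window-right l i b rewrite b | ∨-zeroʳ (bitAt l (suc i)) = ∨-zeroʳ (bitAt l i)

window-cases : ∀ l i → window l i ≡ true →
               bitAt l i ≡ true ⊎ bitAt l (suc i) ≡ true ⊎ bitAt l (suc (suc i)) ≡ true
window-cases l i w with bitAt l i | bitAt l (suc i)
... | true  | _     = inj₁ refl
... | false | true  = inj₂ (inj₁ refl)
... | false | false = inj₂ (inj₂ w)

no000⇒window : ∀ l → no000 l ≡ true → ∀ i → suc (suc i) < length l → window l i ≡ true
no000⇒window (a ∷ []) _ _ (s≤s ())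
no000⇒window (a ∷ b ∷ []) _ _ (s≤s (s≤s ()))
no000⇒window (a ∷ b ∷ c ∷ r) p zero _ = ∧-trueˡ (hasOne a b c) p
no000⇒window (a ∷ b ∷ c ∷ r) p (suc i) (s≤s lt) =
  no000⇒window (b ∷ c ∷ r) (∧-trueʳ (hasOne a b c) p) i lt

window⇒no000 : ∀ l → (∀ i → suc (suc i) < length l → window l i ≡ true) → no000 l ≡ true
window⇒no000 [] w = refl
window⇒no000 (a ∷ []) w = refl
window⇒no000 (a ∷ b ∷ []) w = refl
window⇒no000 (a ∷ b ∷ c ∷ r) w =
  cong₂ _∧_ (w zero (s≤s (s≤s (s≤s z≤n)))) (window⇒no000 (b ∷ c ∷ r) (λ i lt → w (suc i) (s≤s lt)))

bitAt-++ˡ : ∀ l r i → i < length l → bitAt (l ++ r) i ≡ bitAt l i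
bitAt-++ˡ (a ∷ l) r zero _ = refl
bitAt-++ˡ (a ∷ l) r (suc i) (s≤s lt) = bitAt-++ˡ l r i lt

bitAt-∷ʳ : ∀ l a → bitAt (l ++ [ a ]) (length l) ≡ a
bitAt-∷ʳ [] a = refl
bitAt-∷ʳ (b ∷ l) a = bitAt-∷ʳ l a

lastOr-bitAt : ∀ a l → lastOr a l ≡ bitAt (a ∷ l) (length l)
lastOr-bitAt a [] = refl
lastOr-bitAt a (b ∷ l) = lastOr-bitAt b l

lookup-bitAt : ∀ {n} (x : Vec Bool n) (v : Fin n) → lookup x v ≡ bitAt (toList x) (toℕ v)
lookup-bitAt (a V.∷ x) Fin.zero = refl
lookup-bitAt (a V.∷ x) (Fin.suc v) = lookup-bitAt x v

module Unrolling {n : ℕ} (a : Bool) (xs : Vec Bool n) where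

  private
    x : Vec Bool (suc n)
    x = a V.∷ xs

    l : List Bool
    l = toList xs

    unrolled : List Bool
    unrolled = lastOr a l ∷ a ∷ l ++ [ a ]

    length-l : length l ≡ n
    length-l = length-toList xs

    unrolled-length : length unrolled ≡ suc (suc (suc n))
    unrolled-length = cong (λ k → suc (suc k)) (begin
      length (l ++ [ a ]) ≡⟨ length-++ l ⟩
      length l + 1        ≡⟨ cong (_+ 1) length-l ⟩
      n + 1               ≡⟨ +-comm n 1 ⟩
      suc n               ∎)

    unrolled-first : bitAt unrolled 0 ≡ bitAt (a ∷ l) n
    unrolled-first = trans (lastOr-bitAt a l) (cong (bitAt (a ∷ l)) length-l)

    unrolled-middle : ∀ t → t < suc n → bitAt unrolled (suc t) ≡ bitAt (a ∷ l) t
    unrolled-middle t lt = bitAt-++ˡ (a ∷ l) [ a ] t (subst (t <_) (sym (cong suc length-l)) lt)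

    unrolled-last : bitAt unrolled (suc (suc n)) ≡ a
    unrolled-last = trans (cong (λ k → bitAt (l ++ [ a ]) k) (sym length-l)) (bitAt-∷ʳ l a)

    ∈⇒bit : ∀ {u} → u Subset.∈ x → bitAt (a ∷ l) (toℕ u) ≡ true
    ∈⇒bit {u} u∈x = trans (sym (lookup-bitAt x u)) ([]=⇒lookup u∈x)

    bit⇒∈ : ∀ u → bitAt (a ∷ l) (toℕ u) ≡ true → u Subset.∈ x
    bit⇒∈ u b = lookup⇒[]= u x (trans (lookup-bitAt x u) b)

  dominated⇒window : ∀ v → (v Subset.∈ x) ⊎ (∃ λ u → (u Subset.∈ x) × CycleAdj (suc n) u v) →
                     window unrolled (toℕ v) ≡ true
  dominated⇒window v (inj₁ v∈x) =
    window-mid unrolled (toℕ v) (trans (unrolled-middle (toℕ v) (toℕ<n v)) (∈⇒bit v∈x))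
  dominated⇒window v (inj₂ (u , u∈x , inj₁ (inj₁ v≡1+u))) rewrite v≡1+u =
    window-left unrolled (suc (toℕ u)) (trans (unrolled-middle (toℕ u) (toℕ<n u)) (∈⇒bit u∈x))
  dominated⇒window v (inj₂ (u , u∈x , inj₁ (inj₂ (u≡n , v≡0)))) rewrite v≡0 =
    window-left unrolled 0 (trans unrolled-first (subst (λ k → bitAt (a ∷ l) k ≡ true) u≡n (∈⇒bit u∈x)))
  dominated⇒window v (inj₂ (u , u∈x , inj₂ (inj₁ u≡1+v))) =
    window-right unrolled (toℕ v) (subst (λ k → bitAt unrolled (suc k) ≡ true) u≡1+v
      (trans (unrolled-middle (toℕ u) (toℕ<n u)) (∈⇒bit u∈x)))
  dominated⇒window v (inj₂ (u , u∈x , inj₂ (inj₂ (v≡n , u≡0)))) rewrite v≡n =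
    window-right unrolled n (trans unrolled-last (subst (λ k → bitAt (a ∷ l) k ≡ true) u≡0 (∈⇒bit u∈x)))

  dominating⇒cyclic : Dominating (suc n) x → cyclic x ≡ true
  dominating⇒cyclic dom = window⇒no000 unrolled λ i lt →
    let i<N = bound i lt in
    subst (λ k → window unrolled k ≡ true) (toℕ-fromℕ< i<N) (dominated⇒window _ (dom (fromℕ< i<N)))
    where
    bound : ∀ i → suc (suc i) < length unrolled → i < suc n
    bound i lt with subst (suc (suc i) <_) unrolled-length lt
    ... | s≤s (s≤s i<N) = i<N

  cyclic⇒dominating : cyclic x ≡ true → Dominating (suc n) x
  cyclic⇒dominating p v = dominated (window-cases unrolled i (no000⇒window unrolled p i lt))
    where
    i = toℕ v
    i<N : i < suc n
    i<N = toℕ<n v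
    lt : suc (suc i) < length unrolled
    lt = subst (suc (suc i) <_) (sym unrolled-length) (s≤s (s≤s i<N))
    neighbour : ∀ {t} (t<N : t < suc n) → bitAt unrolled (suc t) ≡ true → fromℕ< t<N Subset.∈ x
    neighbour {t} t<N b = bit⇒∈ _ (subst (λ k → bitAt (a ∷ l) k ≡ true) (sym (toℕ-fromℕ< t<N))
                                   (trans (sym (unrolled-middle t t<N)) b))
    dominated : bitAt unrolled i ≡ true ⊎ bitAt unrolled (suc i) ≡ true ⊎ bitAt unrolled (suc (suc i)) ≡ true →
                (v Subset.∈ x) ⊎ (∃ λ u → (u Subset.∈ x) × CycleAdj (suc n) u v)
    dominated (inj₂ (inj₁ b)) = inj₁ (bit⇒∈ v (trans (sym (unrolled-middle i i<N)) b))
    dominated (inj₁ b) with i in eq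
    ... | zero = inj₂ (Fin.fromℕ n , bit⇒∈ (Fin.fromℕ n) (subst (λ k → bitAt (a ∷ l) k ≡ true) (sym (toℕ-fromℕ n))
                         (trans (sym unrolled-first) b)) , inj₁ (inj₂ (toℕ-fromℕ n , refl)))
    ... | suc t = inj₂ (fromℕ< t<N , neighbour t<N b , inj₁ (inj₁ (cong suc (sym (toℕ-fromℕ< t<N)))))
      where
      t<N : t < suc n
      t<N = ≤-trans (n≤1+n (suc t)) (subst (_< suc n) eq i<N)
    dominated (inj₂ (inj₂ b)) with <-cmp (suc i) (suc n)
    ... | tri< 1+i<N _ _ = inj₂ (fromℕ< 1+i<N , neighbour 1+i<N b , inj₂ (inj₁ (toℕ-fromℕ< 1+i<N)))
    ... | tri≈ _ 1+i≡N _ = inj₂ (Fin.zero , bit⇒∈ Fin.zero (trans (sym unrolled-last)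
                              (subst (λ k → bitAt unrolled (suc k) ≡ true) 1+i≡N b)) ,
                              inj₂ (inj₂ (suc-injective 1+i≡N , refl)))
    ... | tri> _ _ 1+i>N = ⊥-elim (<⇒≱ 1+i>N i<N)

dominating⇔cyclic : ∀ {n} (x : Vec Bool (suc n)) → Dominating (suc n) x ⇔ (cyclic x ≡ true)
dominating⇔cyclic (a V.∷ xs) = mk⇔ dominating⇒cyclic cyclic⇒dominating
  where open Unrolling a xs

-- Walks in the hypercube and the parity obstruction

data Flip : ∀ {k} → Vec Bool k → Vec Bool k → Set where
  here  : ∀ {k a b} {xs : Vec Bool k} → a ≢ b → Flip (a V.∷ xs) (b V.∷ xs)
  there : ∀ {k a} {xs ys : Vec Bool k} → Flip xs ys → Flip (a V.∷ xs) (a V.∷ ys)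

flip-sym : ∀ {k} {x y : Vec Bool k} → Flip x y → Flip y x
flip-sym (here a≢b) = here (a≢b ∘ sym)
flip-sym (there f) = there (flip-sym f)

flip-∷ʳ : ∀ {k} {x y : Vec Bool k} {a} → Flip x y → Flip (x ∷ʳ a) (y ∷ʳ a)
flip-∷ʳ (here a≢b) = here a≢b
flip-∷ʳ (there f) = there (flip-∷ʳ f)

flip-last : ∀ {k} (x : Vec Bool k) {a b} → a ≢ b → Flip (x ∷ʳ a) (x ∷ʳ b)
flip-last V.[] a≢b = here a≢b
flip-last (c V.∷ x) a≢b = there (flip-last x a≢b)

flip-last-bit : ∀ {k} (x : Vec Bool k) b → Flip (x ∷ʳ b) (x ∷ʳ not b)
flip-last-bit x b = flip-last x (Bool.not-¬ refl)

flip⇒oneFlip : ∀ {k} {x y : Vec Bool k} → Flip x y → OneFlip k x y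
flip⇒oneFlip (here a≢b) = Fin.zero , a≢b , λ { Fin.zero w≢0 → ⊥-elim (w≢0 refl) ; (Fin.suc w) _ → refl }
flip⇒oneFlip (there f) with flip⇒oneFlip f
... | v , differ , agree = Fin.suc v , differ ,
  λ { Fin.zero _ → refl ; (Fin.suc w) w≢v → agree w (w≢v ∘ cong Fin.suc) }

lookup-extensional : ∀ {A : Set} {k} (x y : Vec A k) → (∀ i → lookup x i ≡ lookup y i) → x ≡ y
lookup-extensional x y eq = begin
  x                     ≡⟨ tabulate∘lookup x ⟨
  V.tabulate (lookup x) ≡⟨ tabulate-cong eq ⟩
  V.tabulate (lookup y) ≡⟨ tabulate∘lookup y ⟩
  y                     ∎

oneFlip⇒flip : ∀ {k} (x y : Vec Bool k) → OneFlip k x y → Flip x y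
oneFlip⇒flip (a V.∷ x) (b V.∷ y) (Fin.zero , a≢b , agree)
  with lookup-extensional x y (λ i → agree (Fin.suc i) (λ ()))
... | refl = here a≢b
oneFlip⇒flip (a V.∷ x) (b V.∷ y) (Fin.suc v , differ , agree) with agree Fin.zero (λ ())
... | refl = there (oneFlip⇒flip x y (v , differ , λ w w≢v → agree (Fin.suc w) (w≢v ∘ FinP.suc-injective)))

flip? : ∀ {k} (x y : Vec Bool k) → Dec (Flip x y)
flip? V.[] V.[] = no λ ()
flip? (a V.∷ x) (b V.∷ y) with a Bool.≟ b
... | yes refl = Dec.map′ there (λ { (here a≢a) → ⊥-elim (a≢a refl) ; (there f) → f }) (flip? x y)
... | no a≢b = Dec.map′ (λ { refl → here a≢b }) (λ { (here _) → refl ; (there _) → ⊥-elim (a≢b refl) })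
                         (VecP.≡-dec Bool._≟_ x y)

data Walk {k} : Vec Bool k → Vec Bool k → List (Vec Bool k) → Set where
  end : ∀ a → Walk a a (a ∷ [])
  _∷_ : ∀ {a b c L} → Flip a b → Walk b c L → Walk a c (a ∷ L)

infixr 5 _++⟨_⟩_
_++⟨_⟩_ : ∀ {k} {a b c d : Vec Bool k} {L M} → Walk a b L → Flip b c → Walk c d M → Walk a d (L ++ M)
end a ++⟨ f ⟩ q = f ∷ q
(g ∷ p) ++⟨ f ⟩ q = g ∷ (p ++⟨ f ⟩ q)

walk-++[] : ∀ {k} {a b : Vec Bool k} {L} → Walk a b L → Walk a b (L ++ [])
walk-++[] {L = L} p = subst (Walk _ _) (sym (++-identityʳ L)) p

walk-map : ∀ {k j} (F : Vec Bool k → Vec Bool j) → (∀ {x y} → Flip x y → Flip (F x) (F y)) →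
           ∀ {a b L} → Walk a b L → Walk (F a) (F b) (map F L)
walk-map F flip-F (end a) = end (F a)
walk-map F flip-F (f ∷ p) = flip-F f ∷ walk-map F flip-F p

walk⇒linked : ∀ {k} {a b : Vec Bool k} {L} → Walk a b L → Linked Flip L
walk⇒linked (end a) = [-]
walk⇒linked (f ∷ end b) = f ∷ [-]
walk⇒linked (f ∷ (g ∷ p)) = f ∷ walk⇒linked (g ∷ p)

linked⇒chain : ∀ {k} {L : List (Vec Bool k)} → Linked Flip L → Chain (OneFlip k) L
linked⇒chain [] = tt
linked⇒chain [-] = tt
linked⇒chain (f ∷ fs) = flip⇒oneFlip f , linked⇒chain fs

sign : ∀ {k} → Vec Bool k → ℤ
sign V.[] = + 1
sign (true V.∷ x) = - sign x
sign (false V.∷ x) = sign x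

sign-∷ʳ : ∀ {k} (xs : Vec Bool k) b → sign (xs ∷ʳ b) ≡ sign (b V.∷ xs)
sign-∷ʳ V.[] b = refl
sign-∷ʳ (true V.∷ xs) true = cong -_ (sign-∷ʳ xs true)
sign-∷ʳ (true V.∷ xs) false = cong -_ (sign-∷ʳ xs false)
sign-∷ʳ (false V.∷ xs) true = sign-∷ʳ xs true
sign-∷ʳ (false V.∷ xs) false = sign-∷ʳ xs false

signSum : ∀ {k} → List (Vec Bool k) → ℤ
signSum [] = + 0
signSum (x ∷ L) = sign x ⊕ signSum L

signSum-++ : ∀ {k} (L M : List (Vec Bool k)) → signSum (L ++ M) ≡ signSum L ⊕ signSum M
signSum-++ [] M = sym (ℤ.+-identityˡ (signSum M))
signSum-++ (x ∷ L) M = trans (cong (sign x ⊕_) (signSum-++ L M)) (sym (ℤ.+-assoc (sign x) (signSum L) (signSum M)))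

signSum-map-neg : ∀ {k j} (F : Vec Bool k → Vec Bool j) → (∀ z → sign (F z) ≡ - sign z) →
                  ∀ L → signSum (map F L) ≡ - signSum L
signSum-map-neg F neg [] = refl
signSum-map-neg F neg (z ∷ L) =
  trans (cong₂ _⊕_ (neg z) (signSum-map-neg F neg L)) (sym (ℤ.neg-distrib-+ (sign z) (signSum L)))

signSum-map-pos : ∀ {k j} (F : Vec Bool k → Vec Bool j) → (∀ z → sign (F z) ≡ sign z) →
                  ∀ L → signSum (map F L) ≡ signSum L
signSum-map-pos F pos [] = refl
signSum-map-pos F pos (z ∷ L) = cong₂ _⊕_ (pos z) (signSum-map-pos F pos L)

signSum-concat : ∀ {k} (Ls : List (List (Vec Bool k))) → signSum (concat Ls) ≡ foldr (λ L s → signSum L ⊕ s) (+ 0) Ls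
signSum-concat [] = refl
signSum-concat (L ∷ Ls) = trans (signSum-++ L (concat Ls)) (cong (signSum L ⊕_) (signSum-concat Ls))

sign-flip : ∀ {k} {x y : Vec Bool k} → Flip x y → sign y ≡ - sign x
sign-flip (here {a = true} {b = true} a≢b) = ⊥-elim (a≢b refl)
sign-flip (here {a = true} {b = false} {xs = xs} _) = sym (ℤ.neg-involutive (sign xs))
sign-flip (here {a = false} {b = true} _) = refl
sign-flip (here {a = false} {b = false} a≢b) = ⊥-elim (a≢b refl)
sign-flip (there {a = true} f) = cong -_ (sign-flip f)
sign-flip (there {a = false} f) = sign-flip f

∣sign∣≡1 : ∀ {k} (x : Vec Bool k) → ∣ sign x ∣ ≡ 1
∣sign∣≡1 V.[] = refl
∣sign∣≡1 (true V.∷ x) = trans (ℤ.∣-i∣≡∣i∣ (sign x)) (∣sign∣≡1 x)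
∣sign∣≡1 (false V.∷ x) = ∣sign∣≡1 x

signSum-↭ : ∀ {k} {L M : List (Vec Bool k)} → L ↭ M → signSum L ≡ signSum M
signSum-↭ ↭.refl = refl
signSum-↭ (↭.prep x p) = cong (sign x ⊕_) (signSum-↭ p)
signSum-↭ (↭.swap {xs = xs} {ys = ys} x y p) = begin
  sign x ⊕ (sign y ⊕ signSum xs) ≡⟨ ℤ.+-assoc (sign x) (sign y) (signSum xs) ⟨
  (sign x ⊕ sign y) ⊕ signSum xs ≡⟨ cong₂ _⊕_ (ℤ.+-comm (sign x) (sign y)) (signSum-↭ p) ⟩
  (sign y ⊕ sign x) ⊕ signSum ys ≡⟨ ℤ.+-assoc (sign y) (sign x) (signSum ys) ⟩
  sign y ⊕ (sign x ⊕ signSum ys) ∎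
signSum-↭ (↭.trans p q) = trans (signSum-↭ p) (signSum-↭ q)

-- Along a walk in the hypercube the signs alternate, so consecutive terms cancel in pairs.
chain-signSum : ∀ {k} (x : Vec Bool k) L → Chain (OneFlip k) (x ∷ L) →
                signSum (x ∷ L) ≡ sign x ⊎ signSum (x ∷ L) ≡ + 0
chain-signSum x [] _ = inj₁ (ℤ.+-identityʳ (sign x))
chain-signSum x (y ∷ L) (x~y , chain) with chain-signSum y L chain
... | inj₁ eq = inj₂ (trans (cong (sign x ⊕_) (trans eq (sign-flip (oneFlip⇒flip x y x~y)))) (ℤ.+-inverseʳ (sign x)))
... | inj₂ eq = inj₁ (trans (cong (sign x ⊕_) eq) (ℤ.+-identityʳ (sign x)))

chain-∣signSum∣≤1 : ∀ {k} (L : List (Vec Bool k)) → Chain (OneFlip k) L → ∣ signSum L ∣ ≤ 1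
chain-∣signSum∣≤1 [] _ = z≤n
chain-∣signSum∣≤1 (x ∷ L) chain with chain-signSum x L chain
... | inj₁ eq = ≤-reflexive (trans (cong ∣_∣ eq) (∣sign∣≡1 x))
... | inj₂ eq rewrite eq = z≤n

record Enumeration (n : ℕ) : Set where
  field
    words        : List (Vec Bool n)
    words-unique : Unique words
    words-cyclic : ∀ {x} → x ∈ words → cyclic x ≡ true
    cyclic-words : ∀ x → cyclic x ≡ true → x ∈ words

module _ {n : ℕ} (E : Enumeration (suc n)) where
  open Enumeration E

  hamiltonian : Linked Flip words → HasHamiltonPathDomGraph (suc n)
  hamiltonian linked =
    words ,
    All.tabulate (λ x∈ → Equivalence.from (dominating⇔cyclic _) (words-cyclic x∈)) ,
    words-unique ,
    (λ D D-dom → cyclic-words D (Equivalence.to (dominating⇔cyclic D) D-dom)) ,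
    linked⇒chain linked

  noHamiltonian : signSum words ≡ + 3 → ¬ HasHamiltonPathDomGraph (suc n)
  noHamiltonian balanced (P , P-dom , P-unique , P-complete , chain) =
    <⇒≱ (s≤s (s≤s z≤n)) (subst (λ s → ∣ s ∣ ≤ 1) (trans (signSum-↭ P↭words) balanced) (chain-∣signSum∣≤1 P chain))
    where
    same-members : ∀ {x} → x ∈ P ⇔ x ∈ words
    same-members {x} = mk⇔
      (λ x∈P → cyclic-words x (Equivalence.to (dominating⇔cyclic x) (All.lookup P-dom x∈P)))
      (λ x∈words → P-complete x (Equivalence.from (dominating⇔cyclic x) (words-cyclic x∈words)))
    P↭words : P ↭ words
    P↭words = ∼bag⇒↭ (unique∧set⇒bag P-unique words-unique same-members)

-- Gray codes of the linear words

oddLength : ∀ {A : Set} → List A → Bool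
oddLength [] = false
oddLength (x ∷ L) = not (oddLength L)

oddLength-++ : ∀ {A : Set} (L M : List A) → oddLength (L ++ M) ≡ oddLength L xor oddLength M
oddLength-++ [] M = refl
oddLength-++ (x ∷ L) M = trans (cong not (oddLength-++ L M)) (Bool.not-distribˡ-xor (oddLength L) (oddLength M))

oddLength-map : ∀ {A B : Set} (f : A → B) (L : List A) → oddLength (map f L) ≡ oddLength L
oddLength-map f [] = refl
oddLength-map f (x ∷ L) = cong not (oddLength-map f L)

ones : ∀ k → Vec Bool k
ones zero = V.[]
ones (suc k) = true V.∷ ones k

alternating : Bool → ∀ k → Vec Bool k
alternating b zero = V.[]
alternating b (suc k) = b V.∷ alternating (not b) k

grayEnd : Bool → ∀ k → Vec Bool k
grayEnd false = ones
grayEnd true = alternating false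

ones-∷ʳ : ∀ k → ones (suc k) ≡ ones k ∷ʳ true
ones-∷ʳ zero = refl
ones-∷ʳ (suc k) = cong (true V.∷_) (ones-∷ʳ k)

alternating-∷ʳ : ∀ q → alternating false (suc (suc (q * 2))) ≡ alternating false (suc (q * 2)) ∷ʳ true
alternating-∷ʳ zero = refl
alternating-∷ʳ (suc q) = cong (λ v → false V.∷ true V.∷ v) (alternating-∷ʳ q)

pre1 : ∀ {k} → Vec Bool k → Vec Bool (suc k)
pre1 z = true V.∷ z

pre01 : ∀ {k} → Vec Bool k → Vec Bool (suc (suc k))
pre01 z = false V.∷ true V.∷ z

pre001 : ∀ {k} → Vec Bool k → Vec Bool (suc (suc (suc k)))
pre001 z = false V.∷ false V.∷ true V.∷ z

gray : Bool → ∀ k → List (Vec Bool k)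
gray d zero = V.[] ∷ []
gray false (suc zero) = (true V.∷ V.[]) ∷ (false V.∷ V.[]) ∷ []
gray true (suc zero) = (false V.∷ V.[]) ∷ (true V.∷ V.[]) ∷ []
gray false (suc (suc zero)) =
  (true V.∷ true V.∷ V.[]) ∷ (true V.∷ false V.∷ V.[]) ∷ (false V.∷ false V.∷ V.[]) ∷ (false V.∷ true V.∷ V.[]) ∷ []
gray true (suc (suc zero)) =
  (false V.∷ true V.∷ V.[]) ∷ (false V.∷ false V.∷ V.[]) ∷ (true V.∷ false V.∷ V.[]) ∷ (true V.∷ true V.∷ V.[]) ∷ []
gray false (suc (suc (suc k))) =
  map pre1 (gray false (suc (suc k))) ++ map pre001 (gray true k) ++ map pre01 (gray false (suc k))
gray true (suc (suc (suc k))) =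
  map pre01 (gray true (suc k)) ++ map pre001 (gray false k) ++ map pre1 (gray true (suc (suc k)))

1→0 : ∀ {k} {xs : Vec Bool k} → Flip (true V.∷ xs) (false V.∷ xs)
1→0 = here λ ()

0→1 : ∀ {k} {xs : Vec Bool k} → Flip (false V.∷ xs) (true V.∷ xs)
0→1 = here λ ()

gray-walk : ∀ d k → Walk (grayEnd d k) (grayEnd (not d) k) (gray d k)
gray-walk false zero = end _
gray-walk true zero = end _
gray-walk false (suc zero) = 1→0 ∷ end _
gray-walk true (suc zero) = 0→1 ∷ end _
gray-walk false (suc (suc zero)) = there 1→0 ∷ 1→0 ∷ there 0→1 ∷ end _
gray-walk true (suc (suc zero)) = there 1→0 ∷ 0→1 ∷ there 0→1 ∷ end _
gray-walk false (suc (suc (suc k))) =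
  walk-map pre1 there (gray-walk false (suc (suc k)))
    ++⟨ 1→0 ⟩ walk-map pre001 (λ f → there (there (there f))) (gray-walk true k)
    ++⟨ there 0→1 ⟩ walk-map pre01 (λ f → there (there f)) (gray-walk false (suc k))
gray-walk true (suc (suc (suc k))) =
  walk-map pre01 (λ f → there (there f)) (gray-walk true (suc k))
    ++⟨ there 1→0 ⟩ walk-map pre001 (λ f → there (there (there f))) (gray-walk false k)
    ++⟨ 0→1 ⟩ walk-map pre1 there (gray-walk true (suc (suc k)))

linear-pre1 : ∀ {k} (z : Vec Bool k) → linear (pre1 z) ≡ linear z
linear-pre1 z = no000-1∷ (toList z)

linear-pre01 : ∀ {k} (z : Vec Bool k) → linear (pre01 z) ≡ linear z
linear-pre01 z = no000-∷1∷ false (toList z)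

linear-pre001 : ∀ {k} (z : Vec Bool k) → linear (pre001 z) ≡ linear z
linear-pre001 z = no000-∷1∷ false (toList z)

all-linear-map : ∀ {k j} (F : Vec Bool k → Vec Bool j) → (∀ z → linear (F z) ≡ linear z) →
                 ∀ {L} → All Linear L → All Linear (map F L)
all-linear-map F linear-F = AllP.map⁺ ∘ All.map (λ {z} → trans (linear-F z))

gray-linear : ∀ d k → All Linear (gray d k)
gray-linear d zero = refl ∷ []
gray-linear false (suc zero) = refl ∷ refl ∷ []
gray-linear true (suc zero) = refl ∷ refl ∷ []
gray-linear false (suc (suc zero)) = refl ∷ refl ∷ refl ∷ refl ∷ []
gray-linear true (suc (suc zero)) = refl ∷ refl ∷ refl ∷ refl ∷ []
gray-linear false (suc (suc (suc k))) =
  AllP.++⁺ (all-linear-map pre1 linear-pre1 (gray-linear false (suc (suc k))))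
    (AllP.++⁺ (all-linear-map pre001 linear-pre001 (gray-linear true k))
              (all-linear-map pre01 linear-pre01 (gray-linear false (suc k))))
gray-linear true (suc (suc (suc k))) =
  AllP.++⁺ (all-linear-map pre01 linear-pre01 (gray-linear true (suc k)))
    (AllP.++⁺ (all-linear-map pre001 linear-pre001 (gray-linear false k))
              (all-linear-map pre1 linear-pre1 (gray-linear true (suc (suc k)))))

gray-complete : ∀ d k (x : Vec Bool k) → Linear x → x ∈ gray d k
gray-complete d zero V.[] _ = here refl
gray-complete false (suc zero) (true V.∷ V.[]) _ = here refl
gray-complete false (suc zero) (false V.∷ V.[]) _ = there (here refl)
gray-complete true (suc zero) (false V.∷ V.[]) _ = here refl
gray-complete true (suc zero) (true V.∷ V.[]) _ = there (here refl)
gray-complete false (suc (suc zero)) (true V.∷ true V.∷ V.[]) _ = here refl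
gray-complete false (suc (suc zero)) (true V.∷ false V.∷ V.[]) _ = there (here refl)
gray-complete false (suc (suc zero)) (false V.∷ false V.∷ V.[]) _ = there (there (here refl))
gray-complete false (suc (suc zero)) (false V.∷ true V.∷ V.[]) _ = there (there (there (here refl)))
gray-complete true (suc (suc zero)) (false V.∷ true V.∷ V.[]) _ = here refl
gray-complete true (suc (suc zero)) (false V.∷ false V.∷ V.[]) _ = there (here refl)
gray-complete true (suc (suc zero)) (true V.∷ false V.∷ V.[]) _ = there (there (here refl))
gray-complete true (suc (suc zero)) (true V.∷ true V.∷ V.[]) _ = there (there (there (here refl)))
gray-complete false (suc (suc (suc k))) (true V.∷ z) p =
  ∈-++⁺ˡ (∈-map⁺ pre1 (gray-complete false _ z (trans (sym (linear-pre1 z)) p)))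
gray-complete false (suc (suc (suc k))) (false V.∷ false V.∷ true V.∷ z) p =
  ∈-++⁺ʳ (map pre1 (gray false _)) (∈-++⁺ˡ (∈-map⁺ pre001 (gray-complete true _ z (trans (sym (linear-pre001 z)) p))))
gray-complete false (suc (suc (suc k))) (false V.∷ true V.∷ z) p =
  ∈-++⁺ʳ (map pre1 (gray false _)) (∈-++⁺ʳ (map pre001 (gray true k))
    (∈-map⁺ pre01 (gray-complete false _ z (trans (sym (linear-pre01 z)) p))))
gray-complete true (suc (suc (suc k))) (false V.∷ true V.∷ z) p =
  ∈-++⁺ˡ (∈-map⁺ pre01 (gray-complete true _ z (trans (sym (linear-pre01 z)) p)))
gray-complete true (suc (suc (suc k))) (false V.∷ false V.∷ true V.∷ z) p =
  ∈-++⁺ʳ (map pre01 (gray true _)) (∈-++⁺ˡ (∈-map⁺ pre001 (gray-complete false _ z (trans (sym (linear-pre001 z)) p))))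
gray-complete true (suc (suc (suc k))) (true V.∷ z) p =
  ∈-++⁺ʳ (map pre01 (gray true _)) (∈-++⁺ʳ (map pre001 (gray false k))
    (∈-map⁺ pre1 (gray-complete true _ z (trans (sym (linear-pre1 z)) p))))
gray-complete d (suc (suc (suc k))) (false V.∷ false V.∷ false V.∷ z) ()

map-disjoint : ∀ {A B C : Set} {F : A → C} {G : B → C} {L M} → (∀ z w → F z ≢ G w) → Disjoint (map F L) (map G M)
map-disjoint {F = F} {G} F≢G (p , q) with ∈-map⁻ F p | ∈-map⁻ G q
... | z , _ , refl | w , _ , Fz≡Gw = F≢G z w Fz≡Gw

gray-unique : ∀ d k → Unique (gray d k)
gray-unique d zero = [] ∷ []
gray-unique false (suc zero) = ((λ ()) ∷ []) ∷ [] ∷ []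
gray-unique true (suc zero) = ((λ ()) ∷ []) ∷ [] ∷ []
gray-unique false (suc (suc zero)) = ((λ ()) ∷ (λ ()) ∷ (λ ()) ∷ []) ∷ ((λ ()) ∷ (λ ()) ∷ []) ∷ ((λ ()) ∷ []) ∷ [] ∷ []
gray-unique true (suc (suc zero)) = ((λ ()) ∷ (λ ()) ∷ (λ ()) ∷ []) ∷ ((λ ()) ∷ (λ ()) ∷ []) ∷ ((λ ()) ∷ []) ∷ [] ∷ []
gray-unique false (suc (suc (suc k))) =
  UP.++⁺ (UP.map⁺ VecP.∷-injectiveʳ (gray-unique false (suc (suc k))))
    (UP.++⁺ (UP.map⁺ (VecP.∷-injectiveʳ ∘ VecP.∷-injectiveʳ ∘ VecP.∷-injectiveʳ) (gray-unique true k))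
            (UP.map⁺ (VecP.∷-injectiveʳ ∘ VecP.∷-injectiveʳ) (gray-unique false (suc k)))
            (map-disjoint λ _ _ ()))
    λ { (p , q) → [ map-disjoint (λ _ _ ()) ∘ (p ,_) , map-disjoint (λ _ _ ()) ∘ (p ,_) ]′
                    (∈-++⁻ (map pre001 (gray true k)) q) }
gray-unique true (suc (suc (suc k))) =
  UP.++⁺ (UP.map⁺ (VecP.∷-injectiveʳ ∘ VecP.∷-injectiveʳ) (gray-unique true (suc k)))
    (UP.++⁺ (UP.map⁺ (VecP.∷-injectiveʳ ∘ VecP.∷-injectiveʳ ∘ VecP.∷-injectiveʳ) (gray-unique false k))
            (UP.map⁺ VecP.∷-injectiveʳ (gray-unique true (suc (suc k))))
            (map-disjoint λ _ _ ()))
    λ { (p , q) → [ map-disjoint (λ _ _ ()) ∘ (p ,_) , map-disjoint (λ _ _ ()) ∘ (p ,_) ]′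
                    (∈-++⁻ (map pre001 (gray false k)) q) }

periodic₄ : ∀ {A : Set} (f : ℕ → A) → (∀ n → f (suc (suc (suc (suc n)))) ≡ f n) → ∀ k q → f (k + q * 4) ≡ f k
periodic₄ f period k zero = cong f (+-identityʳ k)
periodic₄ f period k (suc q) = begin
  f (k + (4 + q * 4))   ≡⟨ cong f (+-assoc k 4 (q * 4)) ⟨
  f ((k + 4) + q * 4)   ≡⟨ cong (λ i → f (i + q * 4)) (+-comm k 4) ⟩
  f (4 + k + q * 4)     ≡⟨ period (k + q * 4) ⟩
  f (k + q * 4)         ≡⟨ periodic₄ f period k q ⟩
  f k                   ∎

linearBalance : ℕ → ℤ
linearBalance zero = + 1
linearBalance (suc zero) = + 0
linearBalance (suc (suc zero)) = + 0
linearBalance (suc (suc (suc zero))) = - (+ 1)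
linearBalance (suc (suc (suc (suc k)))) = linearBalance k

linearBalance-rec : ∀ k → linearBalance (suc (suc (suc k))) ≡ - linearBalance (suc (suc k)) ⊕ (- linearBalance k ⊕ - linearBalance (suc k))
linearBalance-rec zero = refl
linearBalance-rec (suc zero) = refl
linearBalance-rec (suc (suc zero)) = refl
linearBalance-rec (suc (suc (suc zero))) = refl
linearBalance-rec (suc (suc (suc (suc k)))) = linearBalance-rec k

oddLinearCount : ℕ → Bool
oddLinearCount zero = true
oddLinearCount (suc zero) = false
oddLinearCount (suc (suc zero)) = false
oddLinearCount (suc (suc (suc zero))) = true
oddLinearCount (suc (suc (suc (suc k)))) = oddLinearCount k

oddLinearCount-rec : ∀ k → oddLinearCount (suc (suc (suc k))) ≡ oddLinearCount (suc (suc k)) xor (oddLinearCount k xor oddLinearCount (suc k))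
oddLinearCount-rec zero = refl
oddLinearCount-rec (suc zero) = refl
oddLinearCount-rec (suc (suc zero)) = refl
oddLinearCount-rec (suc (suc (suc zero))) = refl
oddLinearCount-rec (suc (suc (suc (suc k)))) = oddLinearCount-rec k

signSum-prefixed : ∀ {i j k l} (A : List (Vec Bool i)) (B : List (Vec Bool j)) (C : List (Vec Bool k))
                   (F : Vec Bool i → Vec Bool l) (G : Vec Bool j → Vec Bool l) (H : Vec Bool k → Vec Bool l) →
                   (∀ z → sign (F z) ≡ - sign z) → (∀ z → sign (G z) ≡ - sign z) → (∀ z → sign (H z) ≡ - sign z) →
                   signSum (map F A ++ map G B ++ map H C) ≡ - signSum A ⊕ (- signSum B ⊕ - signSum C)
signSum-prefixed A B C F G H negF negG negH = begin
  signSum (map F A ++ map G B ++ map H C)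
    ≡⟨ signSum-++ (map F A) _ ⟩
  signSum (map F A) ⊕ signSum (map G B ++ map H C)
    ≡⟨ cong (signSum (map F A) ⊕_) (signSum-++ (map G B) _) ⟩
  signSum (map F A) ⊕ (signSum (map G B) ⊕ signSum (map H C))
    ≡⟨ cong₂ _⊕_ (signSum-map-neg F negF A) (cong₂ _⊕_ (signSum-map-neg G negG B) (signSum-map-neg H negH C)) ⟩
  - signSum A ⊕ (- signSum B ⊕ - signSum C) ∎

oddLength-prefixed : ∀ {A B C D : Set} (As : List A) (Bs : List B) (Cs : List C) (F : A → D) (G : B → D) (H : C → D) →
                     oddLength (map F As ++ map G Bs ++ map H Cs) ≡ oddLength As xor (oddLength Bs xor oddLength Cs)
oddLength-prefixed As Bs Cs F G H = begin
  oddLength (map F As ++ map G Bs ++ map H Cs)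
    ≡⟨ oddLength-++ (map F As) _ ⟩
  oddLength (map F As) xor oddLength (map G Bs ++ map H Cs)
    ≡⟨ cong (oddLength (map F As) xor_) (oddLength-++ (map G Bs) _) ⟩
  oddLength (map F As) xor (oddLength (map G Bs) xor oddLength (map H Cs))
    ≡⟨ cong₂ _xor_ (oddLength-map F As) (cong₂ _xor_ (oddLength-map G Bs) (oddLength-map H Cs)) ⟩
  oddLength As xor (oddLength Bs xor oddLength Cs) ∎

signSum-gray : ∀ d k → signSum (gray d k) ≡ linearBalance k
signSum-gray d zero = refl
signSum-gray false (suc zero) = refl
signSum-gray true (suc zero) = refl
signSum-gray false (suc (suc zero)) = refl
signSum-gray true (suc (suc zero)) = refl
signSum-gray false (suc (suc (suc k))) = begin
  signSum (gray false (suc (suc (suc k))))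
    ≡⟨ signSum-prefixed (gray false (suc (suc k))) (gray true k) (gray false (suc k)) pre1 pre001 pre01
                        (λ _ → refl) (λ _ → refl) (λ _ → refl) ⟩
  - signSum (gray false (suc (suc k))) ⊕ (- signSum (gray true k) ⊕ - signSum (gray false (suc k)))
    ≡⟨ cong₂ _⊕_ (cong -_ (signSum-gray false (suc (suc k))))
                 (cong₂ _⊕_ (cong -_ (signSum-gray true k)) (cong -_ (signSum-gray false (suc k)))) ⟩
  - linearBalance (suc (suc k)) ⊕ (- linearBalance k ⊕ - linearBalance (suc k))
    ≡⟨ linearBalance-rec k ⟨
  linearBalance (suc (suc (suc k))) ∎
signSum-gray true (suc (suc (suc k))) = begin
  signSum (gray true (suc (suc (suc k))))
    ≡⟨ signSum-prefixed (gray true (suc k)) (gray false k) (gray true (suc (suc k))) pre01 pre001 pre1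
                        (λ _ → refl) (λ _ → refl) (λ _ → refl) ⟩
  - signSum (gray true (suc k)) ⊕ (- signSum (gray false k) ⊕ - signSum (gray true (suc (suc k))))
    ≡⟨ cong₂ _⊕_ (cong -_ (signSum-gray true (suc k)))
                 (cong₂ _⊕_ (cong -_ (signSum-gray false k)) (cong -_ (signSum-gray true (suc (suc k))))) ⟩
  - linearBalance (suc k) ⊕ (- linearBalance k ⊕ - linearBalance (suc (suc k)))
    ≡⟨ ℤ-rotate (- linearBalance (suc k)) (- linearBalance k) (- linearBalance (suc (suc k))) ⟩
  - linearBalance (suc (suc k)) ⊕ (- linearBalance k ⊕ - linearBalance (suc k))
    ≡⟨ linearBalance-rec k ⟨
  linearBalance (suc (suc (suc k))) ∎

oddLength-gray : ∀ d k → oddLength (gray d k) ≡ oddLinearCount k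
oddLength-gray d zero = refl
oddLength-gray false (suc zero) = refl
oddLength-gray true (suc zero) = refl
oddLength-gray false (suc (suc zero)) = refl
oddLength-gray true (suc (suc zero)) = refl
oddLength-gray false (suc (suc (suc k))) = begin
  oddLength (gray false (suc (suc (suc k))))
    ≡⟨ oddLength-prefixed (gray false (suc (suc k))) (gray true k) (gray false (suc k)) pre1 pre001 pre01 ⟩
  oddLength (gray false (suc (suc k))) xor (oddLength (gray true k) xor oddLength (gray false (suc k)))
    ≡⟨ cong₂ _xor_ (oddLength-gray false (suc (suc k))) (cong₂ _xor_ (oddLength-gray true k) (oddLength-gray false (suc k))) ⟩
  oddLinearCount (suc (suc k)) xor (oddLinearCount k xor oddLinearCount (suc k))
    ≡⟨ oddLinearCount-rec k ⟨
  oddLinearCount (suc (suc (suc k))) ∎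
oddLength-gray true (suc (suc (suc k))) = begin
  oddLength (gray true (suc (suc (suc k))))
    ≡⟨ oddLength-prefixed (gray true (suc k)) (gray false k) (gray true (suc (suc k))) pre01 pre001 pre1 ⟩
  oddLength (gray true (suc k)) xor (oddLength (gray false k) xor oddLength (gray true (suc (suc k))))
    ≡⟨ cong₂ _xor_ (oddLength-gray true (suc k)) (cong₂ _xor_ (oddLength-gray false k) (oddLength-gray true (suc (suc k)))) ⟩
  oddLinearCount (suc k) xor (oddLinearCount k xor oddLinearCount (suc (suc k)))
    ≡⟨ xor-rotate (oddLinearCount (suc k)) (oddLinearCount k) (oddLinearCount (suc (suc k))) ⟩
  oddLinearCount (suc (suc k)) xor (oddLinearCount k xor oddLinearCount (suc k))
    ≡⟨ oddLinearCount-rec k ⟨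
  oddLinearCount (suc (suc (suc k))) ∎

module Zigzag {k j : ℕ} (F : Vec Bool k → Bool → Vec Bool j)
              (flip-F : ∀ {z z'} c → Flip z z' → Flip (F z c) (F z' c))
              (flip-bit : ∀ z c → Flip (F z c) (F z (not c)))
              (F-injective : ∀ {z z' c c'} → F z c ≡ F z' c' → z ≡ z' × c ≡ c') where

  zigzag : Bool → List (Vec Bool k) → List (Vec Bool j)
  zigzag b [] = []
  zigzag b (z ∷ L) = F z b ∷ F z (not b) ∷ zigzag (not b) L

  zigzag-walk : ∀ b {a e L} → Walk a e L → Walk (F a b) (F e (b xor oddLength L)) (zigzag b L)
  zigzag-walk b (end a) rewrite Bool.xor-comm b true | Bool.true-xor b = flip-bit a b ∷ end _
  zigzag-walk b {L = a ∷ L} (f ∷ p) =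
    flip-bit a b ∷ flip-F (not b) f ∷ subst (λ c → Walk _ (F _ c) (zigzag (not b) L))
                                            (not-xor b (oddLength L)) (zigzag-walk (not b) p)
    where
    not-xor : ∀ x y → not x xor y ≡ x xor not y
    not-xor x y = trans (sym (Bool.not-distribˡ-xor x y)) (Bool.not-distribʳ-xor x y)

  zigzag-∈⁻ : ∀ b L {x} → x ∈ zigzag b L → ∃₂ λ z c → z ∈ L × x ≡ F z c
  zigzag-∈⁻ b (z ∷ L) (here refl) = z , b , here refl , refl
  zigzag-∈⁻ b (z ∷ L) (there (here refl)) = z , not b , here refl , refl
  zigzag-∈⁻ b (z ∷ L) (there (there x∈)) with zigzag-∈⁻ (not b) L x∈
  ... | z' , c , z'∈L , refl = z' , c , there z'∈L , refl

  zigzag-∈⁺ : ∀ b L {z} c → z ∈ L → F z c ∈ zigzag b L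
  zigzag-∈⁺ false (z ∷ L) false (here refl) = here refl
  zigzag-∈⁺ false (z ∷ L) true (here refl) = there (here refl)
  zigzag-∈⁺ true (z ∷ L) false (here refl) = there (here refl)
  zigzag-∈⁺ true (z ∷ L) true (here refl) = here refl
  zigzag-∈⁺ b (z ∷ L) c (there z∈L) = there (there (zigzag-∈⁺ (not b) L c z∈L))

  zigzag-unique : ∀ b L → Unique L → Unique (zigzag b L)
  zigzag-unique b [] _ = []
  zigzag-unique b (z ∷ L) (z∉L ∷ L!) =
    (bits-differ ∷ fresh b) ∷ fresh (not b) ∷ zigzag-unique (not b) L L!
    where
    bits-differ : F z b ≢ F z (not b)
    bits-differ eq = Bool.not-¬ refl (proj₂ (F-injective eq))
    fresh : ∀ c → All (F z c ≢_) (zigzag (not b) L)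
    fresh c = All.tabulate λ y∈ eq → case zigzag-∈⁻ (not b) L y∈ of λ where
      (z' , c' , z'∈L , refl) → AllP.All¬⇒¬Any z∉L (subst (_∈ L) (sym (proj₁ (F-injective eq))) z'∈L)

-- Cyclic words as framed linear words

unique-++ʳ : ∀ {A : Set} (xs : List A) {ys} → Unique (xs ++ ys) → Unique ys
unique-++ʳ [] xs! = xs!
unique-++ʳ (x ∷ xs) (_ ∷ xs!) = unique-++ʳ xs xs!

unique-++-disjoint : ∀ {A : Set} (xs : List A) {ys} → Unique (xs ++ ys) → Disjoint xs ys
unique-++-disjoint (x ∷ xs) (x∉ ∷ _) (here refl , a∈ys) = AllP.All¬⇒¬Any x∉ (∈-++⁺ʳ xs a∈ys)
unique-++-disjoint (x ∷ xs) (_ ∷ xs!) (there a∈xs , a∈ys) = unique-++-disjoint xs xs! (a∈xs , a∈ys)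

Shape : Set
Shape = Fin 10

module Pieces (m : ℕ) where

  Word : Set
  Word = Vec Bool (suc (suc (suc (suc (suc (suc m))))))

  -- A piece is named by the word it spells: z, w, u, v stand for linear words of length m + 3,
  -- m + 2, m + 1, m, the digits are fixed bits and b is a free bit. The linear part always sits
  -- between two ones, so by cyclic-cut₂ the piece is cyclic exactly when that part is linear.
  1z1b : Vec Bool (suc (suc (suc m))) → Bool → Word
  1z1b z b = true V.∷ (z ∷ʳ true ∷ʳ b)

  01w1b : Vec Bool (suc (suc m)) → Bool → Word
  01w1b w b = false V.∷ true V.∷ (w ∷ʳ true ∷ʳ b)

  1w10b : Vec Bool (suc (suc m)) → Bool → Word
  1w10b w b = true V.∷ (w ∷ʳ true ∷ʳ false ∷ʳ b)

  001u11 : Vec Bool (suc m) → Word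
  001u11 u = false V.∷ false V.∷ true V.∷ (u ∷ʳ true ∷ʳ true)

  01u101 : Vec Bool (suc m) → Word
  01u101 u = false V.∷ true V.∷ (u ∷ʳ true ∷ʳ false ∷ʳ true)

  001v101 : Vec Bool m → Word
  001v101 v = false V.∷ false V.∷ true V.∷ (v ∷ʳ true ∷ʳ false ∷ʳ true)

  w1001 : Vec Bool (suc (suc m)) → Word
  w1001 w = w ∷ʳ true ∷ʳ false ∷ʳ false ∷ʳ true

  cyclic-1z1b : ∀ z b → cyclic (1z1b z b) ≡ linear z
  cyclic-1z1b z b = cyclic-framed (1z1b z b) z [] (b ∷ []) (cong (true ∷_) (toList-∷ʳ₂ z true b)) refl

  cyclic-01w1b : ∀ w b → cyclic (01w1b w b) ≡ linear w
  cyclic-01w1b w b =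
    cyclic-framed (01w1b w b) w (false ∷ []) (b ∷ []) (cong (λ l → false ∷ true ∷ l) (toList-∷ʳ₂ w true b)) refl

  cyclic-1w10b : ∀ w b → cyclic (1w10b w b) ≡ linear w
  cyclic-1w10b w b =
    cyclic-framed (1w10b w b) w [] (false ∷ b ∷ []) (cong (true ∷_) (toList-∷ʳ₃ w true false b)) refl

  cyclic-001u11 : ∀ u → cyclic (001u11 u) ≡ linear u
  cyclic-001u11 u = cyclic-framed (001u11 u) u (false ∷ false ∷ []) (true ∷ [])
    (cong (λ l → false ∷ false ∷ true ∷ l) (toList-∷ʳ₂ u true true)) refl

  cyclic-01u101 : ∀ u → cyclic (01u101 u) ≡ linear u
  cyclic-01u101 u = cyclic-framed (01u101 u) u (false ∷ []) (false ∷ true ∷ [])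
    (cong (λ l → false ∷ true ∷ l) (toList-∷ʳ₃ u true false true)) refl

  cyclic-001v101 : ∀ v → cyclic (001v101 v) ≡ linear v
  cyclic-001v101 v = cyclic-framed (001v101 v) v (false ∷ false ∷ []) (false ∷ true ∷ [])
    (cong (λ l → false ∷ false ∷ true ∷ l) (toList-∷ʳ₃ v true false true)) refl

  cyclic-w1001 : ∀ w → cyclic (w1001 w) ≡ linear w
  cyclic-w1001 w = trans (cong cyclicᴸ (toList-∷ʳ₄ w true false false true)) (cyclic-cut₂ (toList w) (false ∷ false ∷ []) [])

  data Piece : Shape → Word → Set where
    1z10ᵖ    : ∀ z → Linear z → Piece (# 0) (1z1b z false)
    1z11ᵖ    : ∀ z → Linear z → Piece (# 1) (1z1b z true)
    01w10ᵖ   : ∀ w → Linear w → Piece (# 2) (01w1b w false)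
    01w11ᵖ   : ∀ w → Linear w → Piece (# 3) (01w1b w true)
    001u11ᵖ  : ∀ u → Linear u → Piece (# 4) (001u11 u)
    1w100ᵖ   : ∀ w → Linear w → Piece (# 5) (1w10b w false)
    1w101ᵖ   : ∀ w → Linear w → Piece (# 6) (1w10b w true)
    01u101ᵖ  : ∀ u → Linear u → Piece (# 7) (01u101 u)
    001v101ᵖ : ∀ v → Linear v → Piece (# 8) (001v101 v)
    w1001ᵖ   : ∀ w → Linear w → Piece (# 9) (w1001 w)

  piece-cyclic : ∀ {c x} → Piece c x → cyclic x ≡ true
  piece-cyclic (1z10ᵖ z p) = trans (cyclic-1z1b z false) p
  piece-cyclic (1z11ᵖ z p) = trans (cyclic-1z1b z true) p
  piece-cyclic (01w10ᵖ w p) = trans (cyclic-01w1b w false) p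
  piece-cyclic (01w11ᵖ w p) = trans (cyclic-01w1b w true) p
  piece-cyclic (001u11ᵖ u p) = trans (cyclic-001u11 u) p
  piece-cyclic (1w100ᵖ w p) = trans (cyclic-1w10b w false) p
  piece-cyclic (1w101ᵖ w p) = trans (cyclic-1w10b w true) p
  piece-cyclic (01u101ᵖ u p) = trans (cyclic-01u101 u) p
  piece-cyclic (001v101ᵖ v p) = trans (cyclic-001v101 v) p
  piece-cyclic (w1001ᵖ w p) = trans (cyclic-w1001 w) p

  shift : Bool × Bool × Bool → Bool → Bool × Bool × Bool
  shift (_ , b , c) d = b , c , d

  lastThree : List Bool → Bool × Bool × Bool
  lastThree = foldl shift (false , false , false)

  classify : (s₂ s₁ a₀ a₁ s₃ : Bool) → Shape
  classify true  _     true  _     false = # 0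
  classify true  _     true  _     true  = # 1
  classify true  _     false true  false = # 2
  classify true  _     false true  true  = # 3
  classify true  _     false false _     = # 4
  classify false true  true  _     false = # 5
  classify false true  true  _     true  = # 6
  classify false true  false true  _     = # 7
  classify false true  false false _     = # 8
  classify false false _     _     _     = # 9

  -- Only the bits that the pieces fix are inspected, so shape computes on every piece.
  shape : Word → Shape
  shape x = let (s₁ , s₂ , s₃) = lastThree (toList x) in
            classify s₂ s₁ (V.head x) (V.head (V.tail x)) s₃

  private
    Register = Bool × Bool × Bool

    read-∷ʳ₂ : ∀ (r : Register) {k} (z : Vec Bool k) a b →
               foldl shift r (toList (z ∷ʳ a ∷ʳ b)) ≡ foldl shift (foldl shift r (toList z)) (a ∷ b ∷ [])
    read-∷ʳ₂ r z a b = trans (cong (foldl shift r) (toList-∷ʳ₂ z a b)) (foldl-++ shift r (toList z) _)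

    read-∷ʳ₃ : ∀ (r : Register) {k} (z : Vec Bool k) a b c →
               foldl shift r (toList (z ∷ʳ a ∷ʳ b ∷ʳ c)) ≡ foldl shift (foldl shift r (toList z)) (a ∷ b ∷ c ∷ [])
    read-∷ʳ₃ r z a b c = trans (cong (foldl shift r) (toList-∷ʳ₃ z a b c)) (foldl-++ shift r (toList z) _)

    read-∷ʳ₄ : ∀ (r : Register) {k} (z : Vec Bool k) a b c d →
               foldl shift r (toList (z ∷ʳ a ∷ʳ b ∷ʳ c ∷ʳ d)) ≡
               foldl shift (foldl shift r (toList z)) (a ∷ b ∷ c ∷ d ∷ [])
    read-∷ʳ₄ r z a b c d = trans (cong (foldl shift r) (toList-∷ʳ₄ z a b c d)) (foldl-++ shift r (toList z) _)

  piece-shape : ∀ {c x} → Piece c x → shape x ≡ c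
  piece-shape (1z10ᵖ z _) rewrite read-∷ʳ₂ (false , false , true) z true false = refl
  piece-shape (1z11ᵖ z _) rewrite read-∷ʳ₂ (false , false , true) z true true = refl
  piece-shape (01w10ᵖ w _) rewrite read-∷ʳ₂ (false , false , true) w true false = refl
  piece-shape (01w11ᵖ w _) rewrite read-∷ʳ₂ (false , false , true) w true true = refl
  piece-shape (001u11ᵖ u _) rewrite read-∷ʳ₂ (false , false , true) u true true = refl
  piece-shape (1w100ᵖ w _) rewrite read-∷ʳ₃ (false , false , true) w true false false = refl
  piece-shape (1w101ᵖ w _) rewrite read-∷ʳ₃ (false , false , true) w true false true = refl
  piece-shape (01u101ᵖ u _) rewrite read-∷ʳ₃ (false , false , true) u true false true = refl
  piece-shape (001v101ᵖ v _) rewrite read-∷ʳ₃ (false , false , true) v true false true = refl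
  piece-shape (w1001ᵖ w _) rewrite read-∷ʳ₄ (false , false , false) w true false false true = refl

  piece-unique : ∀ {c c' x} → Piece c x → Piece c' x → c ≡ c'
  piece-unique P P' = trans (sym (piece-shape P)) (piece-shape P')

  cyclic-form : ∀ a₀ a₁ a₂ (y : Vec Bool m) s₁ s₂ s₃ →
                cyclic (a₀ V.∷ a₁ V.∷ a₂ V.∷ (y ∷ʳ s₁ ∷ʳ s₂ ∷ʳ s₃)) ≡
                no000 (s₃ ∷ a₀ ∷ a₁ ∷ a₂ ∷ toList y ++ s₁ ∷ s₂ ∷ s₃ ∷ a₀ ∷ [])
  cyclic-form a₀ a₁ a₂ y s₁ s₂ s₃ rewrite toList-∷ʳ₃ y s₁ s₂ s₃ =
    cong₂ (λ ℓ t → no000 (ℓ ∷ a₀ ∷ a₁ ∷ a₂ ∷ t))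
          (lastOr-++ a₂ (toList y) s₁ (s₂ ∷ s₃ ∷ []))
          (++-assoc (toList y) (s₁ ∷ s₂ ∷ s₃ ∷ []) [ a₀ ])

  linear-ending : ∀ (w : Vec Bool (suc (suc m))) c d e f →
                  cyclic (w ∷ʳ c ∷ʳ d ∷ʳ e ∷ʳ f) ≡ true → no000 (c ∷ d ∷ e ∷ f ∷ []) ≡ true
  linear-ending w c d e f p =
    no000-++ʳ (toList w) _ (subst (λ l → no000 l ≡ true) (toList-∷ʳ₄ w c d e f) (cyclic⇒linear (w ∷ʳ c ∷ʳ d ∷ʳ e ∷ʳ f) p))

  decompose-by-bits : ∀ a₀ a₁ a₂ (y : Vec Bool m) s₁ s₂ s₃ → s₁ ∨ s₂ ≡ true →
                      hasOne s₃ a₀ a₁ ≡ true → hasOne a₀ a₁ a₂ ≡ true → hasOne s₂ s₃ a₀ ≡ true →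
                      let x = a₀ V.∷ a₁ V.∷ a₂ V.∷ (y ∷ʳ s₁ ∷ʳ s₂ ∷ʳ s₃) in cyclic x ≡ true → ∃ λ c → Piece c x
  decompose-by-bits true a₁ a₂ y s₁ true false _ _ _ _ p =
    -, 1z10ᵖ z (trans (sym (cyclic-1z1b z false)) p)
    where z = a₁ V.∷ a₂ V.∷ (y ∷ʳ s₁)
  decompose-by-bits true a₁ a₂ y s₁ true true _ _ _ _ p =
    -, 1z11ᵖ z (trans (sym (cyclic-1z1b z true)) p)
    where z = a₁ V.∷ a₂ V.∷ (y ∷ʳ s₁)
  decompose-by-bits false true a₂ y s₁ true false _ _ _ _ p =
    -, 01w10ᵖ w (trans (sym (cyclic-01w1b w false)) p)
    where w = a₂ V.∷ (y ∷ʳ s₁)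
  decompose-by-bits false true a₂ y s₁ true true _ _ _ _ p =
    -, 01w11ᵖ w (trans (sym (cyclic-01w1b w true)) p)
    where w = a₂ V.∷ (y ∷ʳ s₁)
  decompose-by-bits false false true y s₁ true true _ _ _ _ p =
    -, 001u11ᵖ (y ∷ʳ s₁) (trans (sym (cyclic-001u11 (y ∷ʳ s₁))) p)
  decompose-by-bits false false true y s₁ true false _ () _ _ _
  decompose-by-bits false false false y s₁ true s₃ _ _ () _ _
  decompose-by-bits true a₁ a₂ y true false false _ _ _ _ p =
    -, 1w100ᵖ w (trans (sym (cyclic-1w10b w false)) p)
    where w = a₁ V.∷ a₂ V.∷ y
  decompose-by-bits true a₁ a₂ y true false true _ _ _ _ p =
    -, 1w101ᵖ w (trans (sym (cyclic-1w10b w true)) p)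
    where w = a₁ V.∷ a₂ V.∷ y
  decompose-by-bits false true a₂ y true false true _ _ _ _ p =
    -, 01u101ᵖ (a₂ V.∷ y) (trans (sym (cyclic-01u101 (a₂ V.∷ y))) p)
  decompose-by-bits false false true y true false true _ _ _ _ p =
    -, 001v101ᵖ y (trans (sym (cyclic-001v101 y)) p)
  decompose-by-bits false a₁ a₂ y true false false _ _ _ () _
  decompose-by-bits false false false y true false true _ _ () _ _
  decompose-by-bits a₀ a₁ a₂ y false false s₃ () _ _ _ _

  decompose-by-prefix : ∀ a₀ a₁ a₂ (y : Vec Bool m) s₁ s₂ s₃ → s₁ ∨ s₂ ≡ true →
                        let x = a₀ V.∷ a₁ V.∷ a₂ V.∷ (y ∷ʳ s₁ ∷ʳ s₂ ∷ʳ s₃) in cyclic x ≡ true → ∃ λ c → Piece c x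
  decompose-by-prefix a₀ a₁ a₂ y s₁ s₂ s₃ s₁∨s₂ p =
    decompose-by-bits a₀ a₁ a₂ y s₁ s₂ s₃ s₁∨s₂
      (∧-trueˡ (hasOne s₃ a₀ a₁) front)
      (∧-trueˡ (hasOne a₀ a₁ a₂) (∧-trueʳ (hasOne s₃ a₀ a₁) front))
      (∧-trueˡ (hasOne s₂ s₃ a₀) (∧-trueʳ (hasOne s₁ s₂ s₃) back))
      p
    where
    unrolled = trans (sym (cyclic-form a₀ a₁ a₂ y s₁ s₂ s₃)) p
    front = no000-++ˡ (s₃ ∷ a₀ ∷ a₁ ∷ a₂ ∷ []) (toList y ++ s₁ ∷ s₂ ∷ s₃ ∷ a₀ ∷ []) unrolled
    back = no000-++ʳ (s₃ ∷ a₀ ∷ a₁ ∷ a₂ ∷ toList y) (s₁ ∷ s₂ ∷ s₃ ∷ a₀ ∷ []) unrolled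

  decompose-ending-00 : ∀ (w : Vec Bool (suc (suc m))) c s₃ →
                        let x = w ∷ʳ c ∷ʳ false ∷ʳ false ∷ʳ s₃ in cyclic x ≡ true → ∃ λ c → Piece c x
  decompose-ending-00 w true true p = -, w1001ᵖ w (trans (sym (cyclic-w1001 w)) p)
  decompose-ending-00 w false s₃ p with linear-ending w false false false s₃ p
  ... | ()
  decompose-ending-00 w true false p with linear-ending w true false false false p
  ... | ()

  decompose : ∀ x → cyclic x ≡ true → ∃ λ c → Piece c x
  decompose x p with V.initLast x
  ... | x₁ , s₃ , refl with V.initLast x₁
  ... | x₂ , s₂ , refl with V.initLast x₂
  ... | t , s₁ , refl = by-suffix t s₁ s₂ s₃ p
    where
    by-suffix : ∀ t s₁ s₂ s₃ → cyclic (t ∷ʳ s₁ ∷ʳ s₂ ∷ʳ s₃) ≡ true → ∃ λ c → Piece c (t ∷ʳ s₁ ∷ʳ s₂ ∷ʳ s₃)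
    by-suffix t false false s₃ p with V.initLast t
    ... | w , c , refl = decompose-ending-00 w c s₃ p
    by-suffix (a₀ V.∷ a₁ V.∷ a₂ V.∷ y) true s₂ s₃ p = decompose-by-prefix a₀ a₁ a₂ y true s₂ s₃ refl p
    by-suffix (a₀ V.∷ a₁ V.∷ a₂ V.∷ y) false true s₃ p = decompose-by-prefix a₀ a₁ a₂ y false true s₃ refl p

  ∷ʳ₂-injective : ∀ {k} (xs ys : Vec Bool k) {a b c d} → xs ∷ʳ a ∷ʳ b ≡ ys ∷ʳ c ∷ʳ d → xs ≡ ys × b ≡ d
  ∷ʳ₂-injective xs ys eq = VecP.∷ʳ-injectiveˡ xs ys (VecP.∷ʳ-injectiveˡ _ _ eq) , VecP.∷ʳ-injectiveʳ _ _ eq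

  ∷ʳ₃-injective : ∀ {k} (xs ys : Vec Bool k) {a b c d e f} → xs ∷ʳ a ∷ʳ b ∷ʳ c ≡ ys ∷ʳ d ∷ʳ e ∷ʳ f → xs ≡ ys × c ≡ f
  ∷ʳ₃-injective xs ys eq = proj₁ (∷ʳ₂-injective xs ys (VecP.∷ʳ-injectiveˡ _ _ eq)) , VecP.∷ʳ-injectiveʳ _ _ eq

  ∷ʳ₄-injectiveˡ : ∀ {k} (xs ys : Vec Bool k) {a b c d} → xs ∷ʳ a ∷ʳ b ∷ʳ c ∷ʳ d ≡ ys ∷ʳ a ∷ʳ b ∷ʳ c ∷ʳ d → xs ≡ ys
  ∷ʳ₄-injectiveˡ xs ys eq = proj₁ (∷ʳ₃-injective xs ys (VecP.∷ʳ-injectiveˡ _ _ eq))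

  drop-∷³ : ∀ {k} {a b c d e f} {xs ys : Vec Bool k} → a V.∷ b V.∷ c V.∷ xs ≡ d V.∷ e V.∷ f V.∷ ys → xs ≡ ys
  drop-∷³ = VecP.∷-injectiveʳ ∘ VecP.∷-injectiveʳ ∘ VecP.∷-injectiveʳ

  record Frame (k : ℕ) : Set where
    field
      frame           : Vec Bool k → Word
      label           : Shape
      piece           : ∀ {z} → Linear z → Piece label (frame z)
      unpiece         : ∀ {x} → Piece label x → ∃ λ z → x ≡ frame z × Linear z
      frame-injective : ∀ {z z'} → frame z ≡ frame z' → z ≡ z'
      frame-flip      : ∀ {z z'} → Flip z z' → Flip (frame z) (frame z')
      flipsSign       : Bool
      frame-sign      : ∀ z → sign (frame z) ≡ (if flipsSign then - sign z else sign z)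

  open Frame

  1z1bᶠ : Bool → Frame (suc (suc (suc m)))
  1z1bᶠ b = record
    { frame = λ z → 1z1b z b ; label = if b then # 1 else # 0 ; piece = framed b _ ; unpiece = unframed b
    ; frame-injective = λ {z} {z'} → proj₁ ∘ ∷ʳ₂-injective z z' ∘ VecP.∷-injectiveʳ
    ; frame-flip = λ f → there (flip-∷ʳ (flip-∷ʳ f)) ; flipsSign = b ; frame-sign = signed b }
    where
    signed : ∀ b z → sign (1z1b z b) ≡ (if b then - sign z else sign z)
    signed false z rewrite sign-∷ʳ (z ∷ʳ true) false | sign-∷ʳ z true = ℤ.neg-involutive (sign z)
    signed true z rewrite sign-∷ʳ (z ∷ʳ true) true | sign-∷ʳ z true = cong -_ (ℤ.neg-involutive (sign z))
    framed : ∀ b z → Linear z → Piece (if b then # 1 else # 0) (1z1b z b)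
    framed false = 1z10ᵖ
    framed true = 1z11ᵖ
    unframed : ∀ b {x} → Piece (if b then # 1 else # 0) x → ∃ λ z → x ≡ 1z1b z b × Linear z
    unframed false (1z10ᵖ z p) = z , refl , p
    unframed true (1z11ᵖ z p) = z , refl , p

  01w1bᶠ : Bool → Frame (suc (suc m))
  01w1bᶠ b = record
    { frame = λ w → 01w1b w b ; label = if b then # 3 else # 2 ; piece = framed b _ ; unpiece = unframed b
    ; frame-injective = λ {w} {w'} → proj₁ ∘ ∷ʳ₂-injective w w' ∘ VecP.∷-injectiveʳ ∘ VecP.∷-injectiveʳ
    ; frame-flip = λ f → there (there (flip-∷ʳ (flip-∷ʳ f))) ; flipsSign = b ; frame-sign = signed b }
    where
    signed : ∀ b w → sign (01w1b w b) ≡ (if b then - sign w else sign w)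
    signed false w rewrite sign-∷ʳ (w ∷ʳ true) false | sign-∷ʳ w true = ℤ.neg-involutive (sign w)
    signed true w rewrite sign-∷ʳ (w ∷ʳ true) true | sign-∷ʳ w true = cong -_ (ℤ.neg-involutive (sign w))
    framed : ∀ b w → Linear w → Piece (if b then # 3 else # 2) (01w1b w b)
    framed false = 01w10ᵖ
    framed true = 01w11ᵖ
    unframed : ∀ b {x} → Piece (if b then # 3 else # 2) x → ∃ λ w → x ≡ 01w1b w b × Linear w
    unframed false (01w10ᵖ w p) = w , refl , p
    unframed true (01w11ᵖ w p) = w , refl , p

  1w10bᶠ : Bool → Frame (suc (suc m))
  1w10bᶠ b = record
    { frame = λ w → 1w10b w b ; label = if b then # 6 else # 5 ; piece = framed b _ ; unpiece = unframed b
    ; frame-injective = λ {w} {w'} → proj₁ ∘ ∷ʳ₃-injective w w' ∘ VecP.∷-injectiveʳ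
    ; frame-flip = λ f → there (flip-∷ʳ (flip-∷ʳ (flip-∷ʳ f))) ; flipsSign = b ; frame-sign = signed b }
    where
    signed : ∀ b w → sign (1w10b w b) ≡ (if b then - sign w else sign w)
    signed false w rewrite sign-∷ʳ (w ∷ʳ true ∷ʳ false) false | sign-∷ʳ (w ∷ʳ true) false | sign-∷ʳ w true =
      ℤ.neg-involutive (sign w)
    signed true w rewrite sign-∷ʳ (w ∷ʳ true ∷ʳ false) true | sign-∷ʳ (w ∷ʳ true) false | sign-∷ʳ w true =
      cong -_ (ℤ.neg-involutive (sign w))
    framed : ∀ b w → Linear w → Piece (if b then # 6 else # 5) (1w10b w b)
    framed false = 1w100ᵖ
    framed true = 1w101ᵖ
    unframed : ∀ b {x} → Piece (if b then # 6 else # 5) x → ∃ λ w → x ≡ 1w10b w b × Linear w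
    unframed false (1w100ᵖ w p) = w , refl , p
    unframed true (1w101ᵖ w p) = w , refl , p

  001u11ᶠ : Frame (suc m)
  001u11ᶠ = record
    { frame = 001u11 ; label = # 4 ; piece = 001u11ᵖ _ ; unpiece = λ { (001u11ᵖ u p) → u , refl , p }
    ; frame-injective = λ {u} {u'} → proj₁ ∘ ∷ʳ₂-injective u u' ∘ drop-∷³
    ; frame-flip = λ f → there (there (there (flip-∷ʳ (flip-∷ʳ f)))) ; flipsSign = true
    ; frame-sign = signed }
    where
    signed : ∀ u → sign (001u11 u) ≡ - sign u
    signed u rewrite sign-∷ʳ (u ∷ʳ true) true | sign-∷ʳ u true = cong -_ (ℤ.neg-involutive (sign u))

  01u101ᶠ : Frame (suc m)
  01u101ᶠ = record
    { frame = 01u101 ; label = # 7 ; piece = 01u101ᵖ _ ; unpiece = λ { (01u101ᵖ u p) → u , refl , p }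
    ; frame-injective = λ {u} {u'} → proj₁ ∘ ∷ʳ₃-injective u u' ∘ VecP.∷-injectiveʳ ∘ VecP.∷-injectiveʳ
    ; frame-flip = λ f → there (there (flip-∷ʳ (flip-∷ʳ (flip-∷ʳ f)))) ; flipsSign = true
    ; frame-sign = signed }
    where
    signed : ∀ u → sign (01u101 u) ≡ - sign u
    signed u rewrite sign-∷ʳ (u ∷ʳ true ∷ʳ false) true | sign-∷ʳ (u ∷ʳ true) false | sign-∷ʳ u true =
      cong -_ (ℤ.neg-involutive (sign u))

  001v101ᶠ : Frame m
  001v101ᶠ = record
    { frame = 001v101 ; label = # 8 ; piece = 001v101ᵖ _ ; unpiece = λ { (001v101ᵖ v p) → v , refl , p }
    ; frame-injective = λ {v} {v'} → proj₁ ∘ ∷ʳ₃-injective v v' ∘ drop-∷³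
    ; frame-flip = λ f → there (there (there (flip-∷ʳ (flip-∷ʳ (flip-∷ʳ f))))) ; flipsSign = true
    ; frame-sign = signed }
    where
    signed : ∀ v → sign (001v101 v) ≡ - sign v
    signed v rewrite sign-∷ʳ (v ∷ʳ true ∷ʳ false) true | sign-∷ʳ (v ∷ʳ true) false | sign-∷ʳ v true =
      cong -_ (ℤ.neg-involutive (sign v))

  w1001ᶠ : Frame (suc (suc m))
  w1001ᶠ = record
    { frame = w1001 ; label = # 9 ; piece = w1001ᵖ _ ; unpiece = λ { (w1001ᵖ w p) → w , refl , p }
    ; frame-injective = λ {w} {w'} → ∷ʳ₄-injectiveˡ w w'
    ; frame-flip = λ f → flip-∷ʳ (flip-∷ʳ (flip-∷ʳ (flip-∷ʳ f))) ; flipsSign = false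
    ; frame-sign = signed }
    where
    signed : ∀ w → sign (w1001 w) ≡ sign w
    signed w rewrite sign-∷ʳ (w ∷ʳ true ∷ʳ false ∷ʳ false) true | sign-∷ʳ (w ∷ʳ true ∷ʳ false) false
                   | sign-∷ʳ (w ∷ʳ true) false | sign-∷ʳ w true = ℤ.neg-involutive (sign w)

  record Block : Set where
    field
      members        : List Word
      shapes         : List Shape
      members-unique : Unique members
      members-pieces : ∀ {x} → x ∈ members → ∃ λ c → c ∈ shapes × Piece c x
      pieces-members : ∀ {c x} → c ∈ shapes → Piece c x → x ∈ members

  open Block

  frameBlock : ∀ {k} → Frame k → Bool → Block
  frameBlock {k} F d = record
    { members = map (frame F) (gray d k)
    ; shapes = [ label F ]
    ; members-unique = UP.map⁺ (frame-injective F) (gray-unique d k)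
    ; members-pieces = λ x∈ → case ∈-map⁻ (frame F) x∈ of λ where
        (z , z∈ , refl) → label F , here refl , piece F (All.lookup (gray-linear d k) z∈)
    ; pieces-members = λ where
        (here refl) P → case unpiece F P of λ where
          (z , refl , p) → ∈-map⁺ (frame F) (gray-complete d k z p)
    }

  zigzagBlock : ∀ {k} (F : Bool → Frame k) →
                (∀ z c → Flip (frame (F c) z) (frame (F (not c)) z)) →
                (∀ {z z' c c'} → frame (F c) z ≡ frame (F c') z' → z ≡ z' × c ≡ c') →
                Bool → Bool → Block
  zigzagBlock {k} F flip-bit injective b d = record
    { members = zigzag b (gray d k)
    ; shapes = label (F false) ∷ label (F true) ∷ []
    ; members-unique = zigzag-unique b _ (gray-unique d k)
    ; members-pieces = λ x∈ → case zigzag-∈⁻ b _ x∈ of λ where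
        (z , c , z∈ , refl) → label (F c) , label∈ c , piece (F c) (All.lookup (gray-linear d k) z∈)
    ; pieces-members = λ where
        (here refl) P → case unpiece (F false) P of λ where
          (z , refl , p) → zigzag-∈⁺ b _ false (gray-complete d k z p)
        (there (here refl)) P → case unpiece (F true) P of λ where
          (z , refl , p) → zigzag-∈⁺ b _ true (gray-complete d k z p)
    }
    where
    open Zigzag (λ z c → frame (F c) z) (λ c → frame-flip (F c)) flip-bit injective
    label∈ : ∀ c → label (F c) ∈ label (F false) ∷ label (F true) ∷ []
    label∈ false = here refl
    label∈ true = there (here refl)

  members⋆ : List Block → List Word
  members⋆ Bs = concat (map members Bs)

  shapes⋆ : List Block → List Shape
  shapes⋆ Bs = concat (map shapes Bs)

  members⋆-pieces : ∀ Bs {x} → x ∈ members⋆ Bs → ∃ λ c → c ∈ shapes⋆ Bs × Piece c x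
  members⋆-pieces (B ∷ Bs) x∈ with ∈-++⁻ (members B) x∈
  ... | inj₁ x∈B = let c , c∈ , P = members-pieces B x∈B in c , ∈-++⁺ˡ c∈ , P
  ... | inj₂ x∈Bs = let c , c∈ , P = members⋆-pieces Bs x∈Bs in c , ∈-++⁺ʳ (shapes B) c∈ , P

  pieces-members⋆ : ∀ Bs {c x} → c ∈ shapes⋆ Bs → Piece c x → x ∈ members⋆ Bs
  pieces-members⋆ (B ∷ Bs) c∈ P with ∈-++⁻ (shapes B) c∈
  ... | inj₁ c∈B = ∈-++⁺ˡ (pieces-members B c∈B P)
  ... | inj₂ c∈Bs = ∈-++⁺ʳ (members B) (pieces-members⋆ Bs c∈Bs P)

  -- A word lies in only one block because its shape does.
  members⋆-unique : ∀ Bs → Unique (shapes⋆ Bs) → Unique (members⋆ Bs)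
  members⋆-unique [] _ = []
  members⋆-unique (B ∷ Bs) shapes! =
    UP.++⁺ (members-unique B) (members⋆-unique Bs (unique-++ʳ (shapes B) shapes!)) λ (x∈B , x∈Bs) →
      let c , c∈B , P = members-pieces B x∈B
          c' , c'∈Bs , P' = members⋆-pieces Bs x∈Bs
      in unique-++-disjoint (shapes B) shapes! (c∈B , subst (_∈ shapes⋆ Bs) (piece-unique P' P) c'∈Bs)

  enumeration : (Bs : List Block) →
                {shapes! : True (unique? (shapes⋆ Bs))} →
                {covered : True (All.all? (_∈? shapes⋆ Bs) (allFin 10))} →
                Enumeration _
  enumeration Bs {shapes!} {covered} = record
    { words = members⋆ Bs
    ; words-unique = members⋆-unique Bs (toWitness {a? = unique? (shapes⋆ Bs)} shapes!)
    ; words-cyclic = λ x∈ → let _ , _ , P = members⋆-pieces Bs x∈ in piece-cyclic P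
    ; cyclic-words = λ x p → let c , P = decompose x p in pieces-members⋆ Bs (all-shapes c) P
    }
    where
    all-shapes : ∀ c → c ∈ shapes⋆ Bs
    all-shapes c = All.lookup (toWitness {a? = All.all? (_∈? shapes⋆ Bs) (allFin 10)} covered) (∈-allFin c)

  frameWalk : ∀ {k} (F : Frame k) d →
              Walk (frame F (grayEnd d k)) (frame F (grayEnd (not d) k)) (members (frameBlock F d))
  frameWalk F d = walk-map (frame F) (frame-flip F) (gray-walk d _)

  1z1b-flip-bit : ∀ z b → Flip (1z1b z b) (1z1b z (not b))
  1z1b-flip-bit z b = there (flip-last-bit (z ∷ʳ true) b)

  01w1b-flip-bit : ∀ w b → Flip (01w1b w b) (01w1b w (not b))
  01w1b-flip-bit w b = there (there (flip-last-bit (w ∷ʳ true) b))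

  1w10b-flip-bit : ∀ w b → Flip (1w10b w b) (1w10b w (not b))
  1w10b-flip-bit w b = there (flip-last-bit (w ∷ʳ true ∷ʳ false) b)

  1z1b-injective : ∀ {z z' b b'} → 1z1b z b ≡ 1z1b z' b' → z ≡ z' × b ≡ b'
  1z1b-injective {z} {z'} = ∷ʳ₂-injective z z' ∘ VecP.∷-injectiveʳ

  1w10b-injective : ∀ {w w' b b'} → 1w10b w b ≡ 1w10b w' b' → w ≡ w' × b ≡ b'
  1w10b-injective {w} {w'} = ∷ʳ₃-injective w w' ∘ VecP.∷-injectiveʳ

  001u11→001v101 : ∀ v → Flip (001u11 (v ∷ʳ true)) (001v101 v)
  001u11→001v101 v = there (there (there (flip-∷ʳ (flip-last (v ∷ʳ true) λ ()))))

  01u101→w1001 : ∀ v → Flip (01u101 (v ∷ʳ true)) (w1001 (false V.∷ true V.∷ v))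
  01u101→w1001 v = there (there (flip-∷ʳ (flip-∷ʳ (flip-last (v ∷ʳ true) λ ()))))

  01u101→01w11 : ∀ v → Flip (01u101 (true V.∷ v)) (01w1b (true V.∷ (v ∷ʳ true)) true)
  01u101→01w11 v = there (there (there (flip-∷ʳ (flip-last (v ∷ʳ true) λ ()))))

  w1001→1w101 : Flip (w1001 (ones (suc (suc m)))) (1w10b (ones (suc (suc m))) true)
  w1001→1w101 = subst (λ t → Flip (w1001 (ones (suc (suc m)))) (t ∷ʳ true ∷ʳ false ∷ʳ true))
                      (sym (ones-∷ʳ (suc (suc m))))
                      (flip-∷ʳ (flip-∷ʳ (flip-last (ones (suc (suc m)) ∷ʳ true) λ ())))

  zigzagWalk : ∀ {k} (F : Bool → Frame k) →
               (flip-bit : ∀ z c → Flip (frame (F c) z) (frame (F (not c)) z)) →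
               (injective : ∀ {z z' c c'} → frame (F c) z ≡ frame (F c') z' → z ≡ z' × c ≡ c') →
               ∀ b d {e} → b xor oddLength (gray d k) ≡ e →
               Walk (frame (F b) (grayEnd d k)) (frame (F e) (grayEnd (not d) k))
                    (members (zigzagBlock F flip-bit injective b d))
  zigzagWalk {k} F flip-bit injective b d refl = zigzag-walk b (gray-walk d k)
    where open Zigzag (λ z c → frame (F c) z) (λ c → frame-flip (F c)) flip-bit injective

  signSum-frameBlock : ∀ {k} (F : Frame k) d →
                       signSum (members (frameBlock F d)) ≡ (if flipsSign F then - linearBalance k else linearBalance k)
  signSum-frameBlock {k} F d with flipsSign F | frame-sign F
  ... | false | sign-F = trans (signSum-map-pos (frame F) sign-F (gray d k)) (signSum-gray d k)
  ... | true  | sign-F = trans (signSum-map-neg (frame F) sign-F (gray d k)) (cong -_ (signSum-gray d k))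

-- The Hamilton paths for n ≢ 0 (mod 4) and the obstruction for n ≡ 0 (mod 4)

module OddLength (q : ℕ) where
  m : ℕ
  m = suc (q * 2)

  open Pieces m

  blocks : List Block
  blocks = frameBlock (1z1bᶠ true) false ∷ frameBlock (1z1bᶠ false) true
         ∷ frameBlock (01w1bᶠ false) false ∷ frameBlock (01w1bᶠ true) true
         ∷ frameBlock 001u11ᶠ false ∷ frameBlock 001v101ᶠ true
         ∷ frameBlock 01u101ᶠ false ∷ frameBlock w1001ᶠ true
         ∷ frameBlock (1w10bᶠ true) false ∷ frameBlock (1w10bᶠ false) true ∷ []

  walk : Walk _ _ (members⋆ blocks)
  walk = frameWalk (1z1bᶠ true) false
    ++⟨ 1z1b-flip-bit (alternating false (3 + m)) true ⟩ frameWalk (1z1bᶠ false) true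
    ++⟨ 1→0 ⟩ frameWalk (01w1bᶠ false) false
    ++⟨ 01w1b-flip-bit (alternating false (2 + m)) false ⟩ frameWalk (01w1bᶠ true) true
    ++⟨ there 1→0 ⟩ frameWalk 001u11ᶠ false
    ++⟨ subst (λ t → Flip (001u11 t) (001v101 (alternating false m))) (sym (alternating-∷ʳ q))
              (001u11→001v101 (alternating false m)) ⟩ frameWalk 001v101ᶠ true
    ++⟨ there 0→1 ⟩ frameWalk 01u101ᶠ false
    ++⟨ subst (λ t → Flip (01u101 t) (w1001 (alternating false (2 + m)))) (sym (alternating-∷ʳ q))
              (01u101→w1001 (alternating false m)) ⟩ frameWalk w1001ᶠ true
    ++⟨ w1001→1w101 ⟩ frameWalk (1w10bᶠ true) false
    ++⟨ 1w10b-flip-bit (alternating false (2 + m)) true ⟩ walk-++[] (frameWalk (1w10bᶠ false) true)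

  hamiltonian-odd : HasHamiltonPathDomGraph (7 + q * 2)
  hamiltonian-odd = hamiltonian (enumeration blocks) (walk⇒linked walk)

module LengthTwoMod4 (q : ℕ) where
  m : ℕ
  m = q * 4

  open Pieces m

  blocks : List Block
  blocks = frameBlock 01u101ᶠ true ∷ frameBlock (01w1bᶠ true) false ∷ frameBlock (01w1bᶠ false) true
         ∷ zigzagBlock 1z1bᶠ 1z1b-flip-bit 1z1b-injective false false
         ∷ frameBlock 001u11ᶠ true ∷ frameBlock 001v101ᶠ false
         ∷ zigzagBlock 1w10bᶠ 1w10b-flip-bit 1w10b-injective true true
         ∷ frameBlock w1001ᶠ false ∷ []

  walk : Walk _ _ (members⋆ blocks)
  walk = frameWalk 01u101ᶠ true
    ++⟨ subst (λ t → Flip (01u101 (ones (suc m))) (01w1b (true V.∷ t) true)) (sym (ones-∷ʳ m))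
              (01u101→01w11 (ones m)) ⟩ frameWalk (01w1bᶠ true) false
    ++⟨ 01w1b-flip-bit (alternating false (2 + m)) true ⟩ frameWalk (01w1bᶠ false) true
    ++⟨ 0→1 ⟩ zigzagWalk 1z1bᶠ 1z1b-flip-bit 1z1b-injective false false
                (trans (oddLength-gray false (3 + m)) (periodic₄ oddLinearCount (λ _ → refl) 3 q))
    ++⟨ 1→0 ⟩ frameWalk 001u11ᶠ true
    ++⟨ subst (λ t → Flip (001u11 t) (001v101 (ones m))) (sym (ones-∷ʳ m)) (001u11→001v101 (ones m)) ⟩
        frameWalk 001v101ᶠ false
    ++⟨ 0→1 ⟩ zigzagWalk 1w10bᶠ 1w10b-flip-bit 1w10b-injective true true
                (cong (true xor_) (trans (oddLength-gray true (2 + m)) (periodic₄ oddLinearCount (λ _ → refl) 2 q)))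
    ++⟨ flip-sym w1001→1w101 ⟩ walk-++[] (frameWalk w1001ᶠ false)

  hamiltonian-2mod4 : HasHamiltonPathDomGraph (6 + q * 4)
  hamiltonian-2mod4 = hamiltonian (enumeration blocks) (walk⇒linked walk)

module LengthZeroMod4 (q : ℕ) where
  m : ℕ
  m = 2 + q * 4

  open Pieces m

  blocks : List Block
  blocks = frameBlock (1z1bᶠ false) false ∷ frameBlock (1z1bᶠ true) false
         ∷ frameBlock (01w1bᶠ false) false ∷ frameBlock (01w1bᶠ true) false
         ∷ frameBlock (1w10bᶠ false) false ∷ frameBlock (1w10bᶠ true) false
         ∷ frameBlock 001u11ᶠ false ∷ frameBlock 01u101ᶠ false ∷ frameBlock 001v101ᶠ false
         ∷ frameBlock w1001ᶠ false ∷ []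

  linearBalance≡ : ∀ j → linearBalance (j + q * 4) ≡ linearBalance j
  linearBalance≡ = λ j → periodic₄ linearBalance (λ _ → refl) j q

  -- The 01w1b and 1w10b blocks cancel in pairs, the 1z1b and 001v101 blocks contribute nothing,
  -- and 001u11, 01u101 and w1001 contribute one each.
  balanced : signSum (members⋆ blocks) ≡ + 3
  balanced = trans (signSum-concat (map Block.members blocks))
    (cong₂ _⊕_ (trans (signSum-frameBlock (1z1bᶠ false) false) (linearBalance≡ 5))
    (cong₂ _⊕_ (trans (signSum-frameBlock (1z1bᶠ true) false) (cong -_ (linearBalance≡ 5)))
    (cong₂ _⊕_ (trans (signSum-frameBlock (01w1bᶠ false) false) (linearBalance≡ 4))
    (cong₂ _⊕_ (trans (signSum-frameBlock (01w1bᶠ true) false) (cong -_ (linearBalance≡ 4)))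
    (cong₂ _⊕_ (trans (signSum-frameBlock (1w10bᶠ false) false) (linearBalance≡ 4))
    (cong₂ _⊕_ (trans (signSum-frameBlock (1w10bᶠ true) false) (cong -_ (linearBalance≡ 4)))
    (cong₂ _⊕_ (trans (signSum-frameBlock 001u11ᶠ false) (cong -_ (linearBalance≡ 3)))
    (cong₂ _⊕_ (trans (signSum-frameBlock 01u101ᶠ false) (cong -_ (linearBalance≡ 3)))
    (cong₂ _⊕_ (trans (signSum-frameBlock 001v101ᶠ false) (cong -_ (linearBalance≡ 2)))
    (cong₂ _⊕_ (trans (signSum-frameBlock w1001ᶠ false) (linearBalance≡ 4)) refl))))))))))

  no-hamiltonian-0mod4 : ¬ HasHamiltonPathDomGraph (8 + q * 4)
  no-hamiltonian-0mod4 = noHamiltonian (enumeration blocks) balanced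

-- Small cycles and the case split

module Exhaustive (n : ℕ) where
  open import Data.List.Relation.Unary.Unique.DecPropositional (VecP.≡-dec {n = n} Bool._≟_)
    using () renaming (unique? to words-unique?)
  open import Data.List.Membership.DecPropositional (VecP.≡-dec {n = n} Bool._≟_)
    using () renaming (_∈?_ to _∈ʷ?_)

  enumeration-by-search : (L : List (Vec Bool n)) →
                          {unique : True (words-unique? L)} →
                          {cyclic-L : True (All.all? (λ x → cyclic x Bool.≟ true) L)} →
                          {complete : False (anySubset? (λ x → (cyclic x Bool.≟ true) ×-dec ¬? (x ∈ʷ? L)))} →
                          Enumeration n
  enumeration-by-search L {unique} {cyclic-L} {complete} = record
    { words = L
    ; words-unique = toWitness {a? = words-unique? L} unique
    ; words-cyclic = All.lookup (toWitness {a? = All.all? (λ x → cyclic x Bool.≟ true) L} cyclic-L)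
    ; cyclic-words = λ x p → Dec.decidable-stable (x ∈ʷ? L) λ x∉L →
        toWitnessFalse {a? = anySubset? (λ x → (cyclic x Bool.≟ true) ×-dec ¬? (x ∈ʷ? L))} complete (x , p , x∉L)
    }

module SmallCycles where
  open V using (_∷_; [])

  private
    pattern O = false
    pattern I = true

  words₃ : List (Vec Bool 3)
  words₃ = (O ∷ O ∷ I ∷ []) ∷ (I ∷ O ∷ I ∷ []) ∷ (I ∷ I ∷ I ∷ []) ∷ (O ∷ I ∷ I ∷ []) ∷ (O ∷ I ∷ O ∷ [])
         ∷ (I ∷ I ∷ O ∷ []) ∷ (I ∷ O ∷ O ∷ []) ∷ []

  words₄ : List (Vec Bool 4)
  words₄ = (O ∷ O ∷ I ∷ I ∷ []) ∷ (O ∷ I ∷ O ∷ I ∷ []) ∷ (O ∷ I ∷ I ∷ O ∷ []) ∷ (O ∷ I ∷ I ∷ I ∷ [])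
         ∷ (I ∷ O ∷ O ∷ I ∷ []) ∷ (I ∷ O ∷ I ∷ O ∷ []) ∷ (I ∷ O ∷ I ∷ I ∷ []) ∷ (I ∷ I ∷ O ∷ O ∷ [])
         ∷ (I ∷ I ∷ O ∷ I ∷ []) ∷ (I ∷ I ∷ I ∷ O ∷ []) ∷ (I ∷ I ∷ I ∷ I ∷ []) ∷ []

  words₅ : List (Vec Bool 5)
  words₅ = (O ∷ O ∷ I ∷ I ∷ I ∷ []) ∷ (I ∷ O ∷ I ∷ I ∷ I ∷ []) ∷ (I ∷ I ∷ I ∷ I ∷ I ∷ []) ∷ (O ∷ I ∷ I ∷ I ∷ I ∷ [])
         ∷ (O ∷ I ∷ O ∷ I ∷ I ∷ []) ∷ (I ∷ I ∷ O ∷ I ∷ I ∷ []) ∷ (I ∷ O ∷ O ∷ I ∷ I ∷ []) ∷ (I ∷ O ∷ O ∷ I ∷ O ∷ [])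
         ∷ (I ∷ I ∷ O ∷ I ∷ O ∷ []) ∷ (O ∷ I ∷ O ∷ I ∷ O ∷ []) ∷ (O ∷ I ∷ I ∷ I ∷ O ∷ []) ∷ (I ∷ I ∷ I ∷ I ∷ O ∷ [])
         ∷ (I ∷ O ∷ I ∷ I ∷ O ∷ []) ∷ (I ∷ O ∷ I ∷ O ∷ O ∷ []) ∷ (I ∷ I ∷ I ∷ O ∷ O ∷ []) ∷ (I ∷ I ∷ I ∷ O ∷ I ∷ [])
         ∷ (I ∷ O ∷ I ∷ O ∷ I ∷ []) ∷ (O ∷ O ∷ I ∷ O ∷ I ∷ []) ∷ (O ∷ I ∷ I ∷ O ∷ I ∷ []) ∷ (O ∷ I ∷ O ∷ O ∷ I ∷ [])
         ∷ (I ∷ I ∷ O ∷ O ∷ I ∷ []) ∷ []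

  hamiltonian-3 : HasHamiltonPathDomGraph 3
  hamiltonian-3 = hamiltonian (Exhaustive.enumeration-by-search 3 words₃) (toWitness {a? = linked? flip? words₃} _)

  hamiltonian-5 : HasHamiltonPathDomGraph 5
  hamiltonian-5 = hamiltonian (Exhaustive.enumeration-by-search 5 words₅) (toWitness {a? = linked? flip? words₅} _)

  no-hamiltonian-4 : ¬ HasHamiltonPathDomGraph 4
  no-hamiltonian-4 = noHamiltonian (Exhaustive.enumeration-by-search 4 words₄) refl

data CycleLength : ℕ → Set where
  three    : CycleLength 3
  four     : CycleLength 4
  five     : CycleLength 5
  odd      : ∀ q → CycleLength (7 + q * 2)
  twoMod4  : ∀ q → CycleLength (6 + q * 4)
  zeroMod4 : ∀ q → CycleLength (8 + q * 4)

cycleLength+4 : ∀ {n} → CycleLength n → CycleLength (4 + n)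
cycleLength+4 three = odd 0
cycleLength+4 four = zeroMod4 0
cycleLength+4 five = odd 1
cycleLength+4 (odd q) = odd (2 + q)
cycleLength+4 (twoMod4 q) = twoMod4 (suc q)
cycleLength+4 (zeroMod4 q) = zeroMod4 (suc q)

cycleLength : ∀ k → CycleLength (3 + k)
cycleLength zero = three
cycleLength (suc zero) = four
cycleLength (suc (suc zero)) = five
cycleLength (suc (suc (suc zero))) = twoMod4 0
cycleLength (suc (suc (suc (suc k)))) = cycleLength+4 (cycleLength k)

∣m+q*d⇒∣m : ∀ {d} m q → d ∣ m + q * d → d ∣ m
∣m+q*d⇒∣m {d} m q d∣ = ∣m+n∣m⇒∣n (subst (d ∣_) (+-comm m (q * d)) d∣) (n∣m*n q)

hamiltonian⇔4∤ : ∀ {n} → CycleLength n → HasHamiltonPathDomGraph n ⇔ (¬ 4 ∣ n)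
hamiltonian⇔4∤ three = mk⇔ (λ _ → from-no (4 ∣? 3)) (λ _ → SmallCycles.hamiltonian-3)
hamiltonian⇔4∤ five = mk⇔ (λ _ → from-no (4 ∣? 5)) (λ _ → SmallCycles.hamiltonian-5)
hamiltonian⇔4∤ (odd q) =
  mk⇔ (λ _ 4∣n → from-no (2 ∣? 7) (∣m+q*d⇒∣m 7 q (∣-trans (divides 2 refl) 4∣n)))
      (λ _ → OddLength.hamiltonian-odd q)
hamiltonian⇔4∤ (twoMod4 q) =
  mk⇔ (λ _ 4∣n → from-no (4 ∣? 6) (∣m+q*d⇒∣m 6 q 4∣n))
      (λ _ → LengthTwoMod4.hamiltonian-2mod4 q)
hamiltonian⇔4∤ four = mk⇔ (⊥-elim ∘ SmallCycles.no-hamiltonian-4) (λ 4∤4 → ⊥-elim (4∤4 (divides 1 refl)))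
hamiltonian⇔4∤ (zeroMod4 q) =
  mk⇔ (⊥-elim ∘ LengthZeroMod4.no-hamiltonian-0mod4 q) (λ 4∤n → ⊥-elim (4∤n (divides (2 + q) refl)))

theorem1p5 : (n : ℕ) → 3 ≤ n → (HasHamiltonPathDomGraph n ⇔ (¬ (4 ∣ n)))
theorem1p5 (suc (suc (suc k))) (s≤s (s≤s (s≤s z≤n))) = hamiltonian⇔4∤ (cycleLength k)
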